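{- Fix an integer $r>0$. For integers $m,n\ge r$, let $\mathbf{M}$, $\mathbf{X}$, $\mathbf{Y}$ be independent random matrices, uniformly distributed respectively on the set of $m\times n$ rank-$r$ matrices over $\mathbb{F}_q$, on $\mathbb{F}_q^{m\times r}$, and on $\mathbb{F}_q^{r\times n}$. Then $$\sum_{\mathbf{N}\in\mathbb{F}_q^{m\times n}}\Big|\mathbb{P}[\mathbf{X}\mathbf{Y}=\mathbf{N}]-\mathbb{P}[\mathbf{M}=\mathbf{N}]\Big|\to0$$ as $m,n\to+\infty$ with $r$ fixed.
   Context: $\mathbb{F}_q$ is a finite field with $q$ elements; $\mathbb{F}_q^{s\times t}$ denotes the set of all $s\times t$ matrices over $\mathbb{F}_q$. -}

module Defs where

open import Level using (Level; _⊔_) renaming (suc to lsuc)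
open import Algebra.Bundles using (CommutativeRing)
open import Data.Nat as ℕ using (ℕ; zero; suc; _^_)
open import Data.Fin using (Fin; zero; suc)
open import Data.Bool using (Bool; true; false; if_then_else_)
open import Data.List using (List; []; _∷_; map; concatMap; foldr; length)
open import Data.Product using (Σ; _×_; _,_; ∃)
open import Data.Integer using (ℤ; +_)
open import Data.Rational as ℚ using (ℚ; 0ℚ)
open import Relation.Nullary using (¬_; Dec; does)
open import Relation.Binary.PropositionalEquality using (_≡_)

record FiniteField (c ℓ : Level) : Set (lsuc (c ⊔ ℓ)) where
  field
    commRing : CommutativeRing c ℓ
  open CommutativeRing commRing public
  field
    0≉1      : ¬ (0# ≈ 1#)
    inverse  : ∀ x → ¬ (x ≈ 0#) → ∃ λ y → (x * y) ≈ 1#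
    _≟_      : ∀ x y → Dec (x ≈ y)
    q        : ℕ
    elem     : Fin q → Carrier
    elem-inj : ∀ i j → elem i ≈ elem j → i ≡ j
    elem-sur : ∀ x → ∃ λ i → elem i ≈ x

allFuns : ∀ {a} {A : Set a} (k : ℕ) → List A → List (Fin k → A)
allFuns zero    xs = (λ ()) ∷ []
allFuns (suc k) xs =
  concatMap (λ x → map (λ f → λ { zero → x ; (suc i) → f i }) (allFuns k xs)) xs

count : ∀ {a} {A : Set a} → (A → Bool) → List A → ℕ
count p = foldr (λ x n → if p x then suc n else n) 0

sumℚ : ∀ {a} {A : Set a} → (A → ℚ) → List A → ℚ
sumℚ f = foldr (λ x s → f x ℚ.+ s) 0ℚ

-- division by a natural number, with the (irrelevant here) convention x/0 = 0
_/ℕ_ : ℕ → ℕ → ℚ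
n /ℕ zero  = 0ℚ
n /ℕ suc d = (+ n) ℚ./ suc d

module _ {c ℓ} (F : FiniteField c ℓ) where
  open FiniteField F using (Carrier; _≈_; _+_; _*_; 0#; 1#; _≟_; q; elem)

  Mat : ℕ → ℕ → Set c
  Mat m n = Fin m → Fin n → Carrier

  elems : List Carrier
  elems = Data.List.tabulate elem
    where import Data.List

  allMats : (m n : ℕ) → List (Mat m n)
  allMats m n = allFuns m (allFuns n elems)

  Σ[_]_ : (k : ℕ) → (Fin k → Carrier) → Carrier
  Σ[ zero ]  f = 0#
  Σ[ suc k ] f = f zero + Σ[ k ] (λ i → f (suc i))

  _⊗_ : ∀ {m r n} → Mat m r → Mat r n → Mat m n
  _⊗_ {r = r} X Y i j = Σ[ r ] (λ k → X i k * Y k j)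

  _≈M_ : ∀ {m n} → Mat m n → Mat m n → Set ℓ
  A ≈M B = ∀ i j → A i j ≈ B i j

  allFin : ∀ k → (Fin k → Bool) → Bool
  allFin zero    p = true
  allFin (suc k) p = if p zero then allFin k (λ i → p (suc i)) else false

  eqM? : ∀ {m n} → Mat m n → Mat m n → Bool
  eqM? {m} {n} A B = allFin m (λ i → allFin n (λ j → does (A i j ≟ B i j)))

  LinIndep : ∀ {m k} → (Fin k → Fin m → Carrier) → Set (c ⊔ ℓ)
  LinIndep {m} {k} v =
    ∀ (coef : Fin k → Carrier) →
      (∀ i → Σ[ k ] (λ j → coef j * v j i) ≈ 0#) → ∀ j → coef j ≈ 0#

  HasIndepCols : ∀ {m n} → ℕ → Mat m n → Set (c ⊔ ℓ)
  HasIndepCols {m} {n} k N =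
    Σ (Fin k → Fin n) λ sel → LinIndep (λ j i → N i (sel j))

  HasRank : ∀ {m n} → ℕ → Mat m n → Set (c ⊔ ℓ)
  HasRank r N = HasIndepCols r N × ¬ HasIndepCols (suc r) N

  -- The rank predicate is counted via a
  -- supplied decision procedure (any two agree).
  module _ (r : ℕ) (rank? : ∀ {m n} (N : Mat m n) → Dec (HasRank r N)) where

    #pairsXY : ∀ m n → Mat m n → ℕ
    #pairsXY m n N =
      foldr (λ X s → count (λ Y → eqM? (X ⊗ Y) N) (allMats r n) ℕ.+ s) 0 (allMats m r)

    #rank : ∀ m n → ℕ
    #rank m n = count (λ N → does (rank? N)) (allMats m n)

    probXY : ∀ m n → Mat m n → ℚ
    probXY m n N = #pairsXY m n N /ℕ (q ^ (m ℕ.* r ℕ.+ r ℕ.* n))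

    probM : ∀ m n → Mat m n → ℚ
    probM m n N = (if does (rank? N) then 1 else 0) /ℕ #rank m n

    tvSum : ∀ m n → ℚ
    tvSum m n = sumℚ (λ N → ℚ.∣ probXY m n N ℚ.- probM m n N ∣) (allMats m n)

{-# OPTIONS --safe #-}

-- Let N have rank r, with independent columns sel, and let X₀ consist of these
-- columns.  Then N = X₀ Y₀ for some Y₀, and (G , H) ↦ (X₀ G , H Y₀) is a bijection
-- from the pairs with G H = I onto the pairs with X Y = N (for surjectivity one
-- inverts an r × r matrix, using that an injective self-map of a finite set is
-- onto).  So X Y conditioned on having rank r is uniform on the rank-r matrices,
-- and the total variation sum is exactly 2 b / q^(mr+rn), where b counts the pairs
-- whose product does not have rank r.
-- If the rows of X contain an r × r identity block, and so do the columns of Y,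
-- then X Y has rank r.  Cutting the rows of X into K blocks of r rows, the fraction
-- of X without identity block is (1 - q^(-r²))^K ≤ q^(r²) / K, and likewise for Y;
-- hence b / q^(mr+rn) → 0.

module Submission where

open import Data.Nat using (ℕ)
open import Defs using (FiniteField; Mat; HasRank)
open import Relation.Nullary using (Dec)

module Counting where

  open import Algebra.Properties.CommutativeSemigroup using (interchange)
  open import Data.Bool using (Bool; true; false; not; _∧_; _∨_; T; if_then_else_)
  open import Data.Empty using (⊥-elim)
  open import Data.Fin using (Fin; zero; suc; _↑ˡ_; _↑ʳ_)
  import Data.Fin.Properties as Fin
  open import Data.List using (List; []; _∷_; foldr; map; concatMap; length; _++_; cartesianProduct; tabulate)
  open import Data.List.Properties using (length-++; length-map)
  open import Data.Nat using (ℕ; zero; suc; _+_; _*_; _^_; _≤_; _<_; z≤n; s≤s)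
  open import Data.Nat.Properties
  open import Data.Product using (_×_; _,_; ∃; proj₁; proj₂)
  open import Data.Unit using (tt)
  open import Data.Vec.Functional using () renaming (_∷_ to _∷ᵛ_)
  open import Function using (_∘_; const)
  open import Relation.Binary.PropositionalEquality
  open import Relation.Nullary using (does)
  open import Defs using (count; allFuns)

  𝟙 : Bool → ℕ
  𝟙 b = if b then 1 else 0

  𝟙-∧ : ∀ a b → 𝟙 (a ∧ b) ≡ 𝟙 a * 𝟙 b
  𝟙-∧ true  b = sym (+-identityʳ (𝟙 b))
  𝟙-∧ false b = refl

  𝟙-∨ : ∀ a b → 𝟙 (a ∨ b) ≤ 𝟙 a + 𝟙 b
  𝟙-∨ true  b = s≤s z≤n
  𝟙-∨ false b = ≤-refl

  𝟙-split : ∀ a x → 𝟙 a * x + 𝟙 (not a) * x ≡ 1 * x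
  𝟙-split true  x = +-identityʳ (1 * x)
  𝟙-split false x = refl

  sumℕ : ∀ {a} {A : Set a} → (A → ℕ) → List A → ℕ
  sumℕ f = foldr (λ x s → f x + s) 0

  module _ {a} {A : Set a} where

    sumℕ-cong : ∀ {f g : A → ℕ} xs → f ≗ g → sumℕ f xs ≡ sumℕ g xs
    sumℕ-cong []       f≗g = refl
    sumℕ-cong (x ∷ xs) f≗g = cong₂ _+_ (f≗g x) (sumℕ-cong xs f≗g)

    sumℕ-mono : ∀ {f g : A → ℕ} xs → (∀ x → f x ≤ g x) → sumℕ f xs ≤ sumℕ g xs
    sumℕ-mono []       f≤g = z≤n
    sumℕ-mono (x ∷ xs) f≤g = +-mono-≤ (f≤g x) (sumℕ-mono xs f≤g)

    sumℕ-distrib-+ : ∀ (f g : A → ℕ) xs → sumℕ (λ x → f x + g x) xs ≡ sumℕ f xs + sumℕ g xs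
    sumℕ-distrib-+ f g []       = refl
    sumℕ-distrib-+ f g (x ∷ xs) =
      trans (cong ((f x + g x) +_) (sumℕ-distrib-+ f g xs)) (interchange +-commutativeSemigroup (f x) (g x) _ _)

    sumℕ-*ˡ : ∀ k (f : A → ℕ) xs → sumℕ (λ x → k * f x) xs ≡ k * sumℕ f xs
    sumℕ-*ˡ k f []       = sym (*-zeroʳ k)
    sumℕ-*ˡ k f (x ∷ xs) = trans (cong (k * f x +_) (sumℕ-*ˡ k f xs)) (sym (*-distribˡ-+ k (f x) _))

    sumℕ-*ʳ : ∀ k (f : A → ℕ) xs → sumℕ (λ x → f x * k) xs ≡ sumℕ f xs * k
    sumℕ-*ʳ k f xs = trans (sumℕ-cong xs (λ x → *-comm (f x) k)) (trans (sumℕ-*ˡ k f xs) (*-comm k _))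

    sumℕ-const : ∀ k (xs : List A) → sumℕ (const k) xs ≡ length xs * k
    sumℕ-const k []       = refl
    sumℕ-const k (x ∷ xs) = cong (k +_) (sumℕ-const k xs)

    sumℕ-++ : ∀ (f : A → ℕ) xs ys → sumℕ f (xs ++ ys) ≡ sumℕ f xs + sumℕ f ys
    sumℕ-++ f []       ys = refl
    sumℕ-++ f (x ∷ xs) ys = trans (cong (f x +_) (sumℕ-++ f xs ys)) (sym (+-assoc (f x) _ _))

    count≡sumℕ : ∀ (p : A → Bool) xs → count p xs ≡ sumℕ (𝟙 ∘ p) xs
    count≡sumℕ p []       = refl
    count≡sumℕ p (x ∷ xs) with p x
    ... | true  = cong suc (count≡sumℕ p xs)
    ... | false = count≡sumℕ p xs

    count-cong : ∀ {p p′ : A → Bool} xs → p ≗ p′ → count p xs ≡ count p′ xs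
    count-cong {p} {p′} xs p≗p′ = begin
      count p xs          ≡⟨ count≡sumℕ p xs ⟩
      sumℕ (𝟙 ∘ p) xs     ≡⟨ sumℕ-cong xs (cong 𝟙 ∘ p≗p′) ⟩
      sumℕ (𝟙 ∘ p′) xs    ≡⟨ count≡sumℕ p′ xs ⟨
      count p′ xs         ∎
      where open ≡-Reasoning

    count-mono : ∀ {p p′ : A → Bool} xs → (∀ x → T (p x) → T (p′ x)) → count p xs ≤ count p′ xs
    count-mono []       p⊆p′ = z≤n
    count-mono {p} {p′} (x ∷ xs) p⊆p′ with p x | p′ x | p⊆p′ x
    ... | true  | true  | _   = s≤s (count-mono xs p⊆p′)
    ... | true  | false | p⇒p′ = ⊥-elim (p⇒p′ tt)
    ... | false | true  | _   = m≤n⇒m≤1+n (count-mono xs p⊆p′)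
    ... | false | false | _   = count-mono xs p⊆p′

    count-≡0 : ∀ {p : A → Bool} xs → (∀ x → p x ≡ false) → count p xs ≡ 0
    count-≡0 []       ¬p = refl
    count-≡0 (x ∷ xs) ¬p rewrite ¬p x = count-≡0 xs ¬p

    count-witness : ∀ (p : A → Bool) xs → 0 < count p xs → ∃ λ x → T (p x)
    count-witness p (x ∷ xs) 0<c with p x in px
    ... | true  = x , subst T (sym px) tt
    ... | false = count-witness p xs 0<c

    count-∧ˡ : ∀ b (p : A → Bool) xs → count (λ x → b ∧ p x) xs ≡ 𝟙 b * count p xs
    count-∧ˡ true  p xs = sym (+-identityʳ (count p xs))
    count-∧ˡ false p xs = count-≡0 xs (λ _ → refl)

    count-true : ∀ (xs : List A) → count (const true) xs ≡ length xs
    count-true []       = refl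
    count-true (x ∷ xs) = cong suc (count-true xs)

    count-not : ∀ (p : A → Bool) xs → count (not ∘ p) xs + count p xs ≡ length xs
    count-not p []       = refl
    count-not p (x ∷ xs) with p x
    ... | true  = trans (+-suc _ _) (cong suc (count-not p xs))
    ... | false = cong suc (count-not p xs)

  sumℕ-map : ∀ {a b} {A : Set a} {B : Set b} (f : B → ℕ) (g : A → B) xs →
             sumℕ f (map g xs) ≡ sumℕ (f ∘ g) xs
  sumℕ-map f g []       = refl
  sumℕ-map f g (x ∷ xs) = cong (f (g x) +_) (sumℕ-map f g xs)

  sumℕ-concatMap : ∀ {a b} {A : Set a} {B : Set b} (f : B → ℕ) (g : A → List B) xs →
                   sumℕ f (concatMap g xs) ≡ sumℕ (sumℕ f ∘ g) xs
  sumℕ-concatMap f g []       = refl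
  sumℕ-concatMap f g (x ∷ xs) =
    trans (sumℕ-++ f (g x) (concatMap g xs)) (cong (sumℕ f (g x) +_) (sumℕ-concatMap f g xs))

  sumℕ-comm : ∀ {a b} {A : Set a} {B : Set b} (f : A → B → ℕ) xs ys →
              sumℕ (λ x → sumℕ (f x) ys) xs ≡ sumℕ (λ y → sumℕ (λ x → f x y) xs) ys
  sumℕ-comm f []       ys = sym (trans (sumℕ-const 0 ys) (*-zeroʳ (length ys)))
  sumℕ-comm f (x ∷ xs) ys =
    trans (cong (sumℕ (f x) ys +_) (sumℕ-comm f xs ys)) (sym (sumℕ-distrib-+ (f x) _ ys))

  sumℕ-cartesianProduct : ∀ {a b} {A : Set a} {B : Set b} (f : A × B → ℕ) xs ys →
    sumℕ f (cartesianProduct xs ys) ≡ sumℕ (λ x → sumℕ (λ y → f (x , y)) ys) xs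
  sumℕ-cartesianProduct f []       ys = refl
  sumℕ-cartesianProduct f (x ∷ xs) ys =
    trans (sumℕ-++ f (map (x ,_) ys) (cartesianProduct xs ys))
          (cong₂ _+_ (sumℕ-map f (x ,_) ys) (sumℕ-cartesianProduct f xs ys))

  length-cartesianProduct : ∀ {a b} {A : Set a} {B : Set b} (xs : List A) (ys : List B) →
    length (cartesianProduct xs ys) ≡ length xs * length ys
  length-cartesianProduct []       ys = refl
  length-cartesianProduct (x ∷ xs) ys = begin
    length (map (x ,_) ys ++ cartesianProduct xs ys)          ≡⟨ length-++ (map (x ,_) ys) ⟩
    length (map (x ,_) ys) + length (cartesianProduct xs ys)  ≡⟨ cong₂ _+_ (length-map (x ,_) ys) (length-cartesianProduct xs ys) ⟩
    length ys + length xs * length ys                         ∎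
    where open ≡-Reasoning

  count-cartesianProduct-∧ : ∀ {a b} {A : Set a} {B : Set b} (p : A → Bool) (p′ : B → Bool) xs ys →
    count (λ xy → p (proj₁ xy) ∧ p′ (proj₂ xy)) (cartesianProduct xs ys) ≡ count p xs * count p′ ys
  count-cartesianProduct-∧ p p′ xs ys = begin
    count (λ xy → p (proj₁ xy) ∧ p′ (proj₂ xy)) (cartesianProduct xs ys)
      ≡⟨ trans (count≡sumℕ _ (cartesianProduct xs ys)) (sumℕ-cartesianProduct _ xs ys) ⟩
    sumℕ (λ x → sumℕ (λ y → 𝟙 (p x ∧ p′ y)) ys) xs
      ≡⟨ sumℕ-cong xs (λ x → trans (sumℕ-cong ys (λ y → 𝟙-∧ (p x) (p′ y))) (sumℕ-*ˡ (𝟙 (p x)) (𝟙 ∘ p′) ys)) ⟩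
    sumℕ (λ x → 𝟙 (p x) * sumℕ (𝟙 ∘ p′) ys) xs
      ≡⟨ sumℕ-*ʳ (sumℕ (𝟙 ∘ p′) ys) (𝟙 ∘ p) xs ⟩
    sumℕ (𝟙 ∘ p) xs * sumℕ (𝟙 ∘ p′) ys
      ≡⟨ cong₂ _*_ (count≡sumℕ p xs) (count≡sumℕ p′ ys) ⟨
    count p xs * count p′ ys
      ∎
    where open ≡-Reasoning

  count-cartesianProduct-∨ : ∀ {a b} {A : Set a} {B : Set b} (p : A → Bool) (p′ : B → Bool) xs ys →
    count (λ xy → p (proj₁ xy) ∨ p′ (proj₂ xy)) (cartesianProduct xs ys) ≤
    count p xs * length ys + length xs * count p′ ys
  count-cartesianProduct-∨ p p′ xs ys = begin
    count (λ xy → p (proj₁ xy) ∨ p′ (proj₂ xy)) (cartesianProduct xs ys)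
      ≡⟨ trans (count≡sumℕ _ (cartesianProduct xs ys)) (sumℕ-cartesianProduct _ xs ys) ⟩
    sumℕ (λ x → sumℕ (λ y → 𝟙 (p x ∨ p′ y)) ys) xs
      ≤⟨ sumℕ-mono xs (λ x → sumℕ-mono ys (λ y → 𝟙-∨ (p x) (p′ y))) ⟩
    sumℕ (λ x → sumℕ (λ y → 𝟙 (p x) + 𝟙 (p′ y)) ys) xs
      ≡⟨ sumℕ-cong xs (λ x → trans (sumℕ-distrib-+ _ _ ys) (cong₂ _+_ (sumℕ-const (𝟙 (p x)) ys) (sym (count≡sumℕ p′ ys)))) ⟩
    sumℕ (λ x → length ys * 𝟙 (p x) + count p′ ys) xs
      ≡⟨ sumℕ-distrib-+ _ _ xs ⟩
    sumℕ (λ x → length ys * 𝟙 (p x)) xs + sumℕ (const (count p′ ys)) xs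
      ≡⟨ cong₂ _+_ (trans (sumℕ-*ˡ (length ys) (𝟙 ∘ p) xs) (trans (cong (length ys *_) (sym (count≡sumℕ p xs))) (*-comm (length ys) _)))
                   (sumℕ-const (count p′ ys) xs) ⟩
    count p xs * length ys + length xs * count p′ ys
      ∎
    where open ≤-Reasoning

  module _ {a} {A : Set a} (xs : List A) where

    -- allFuns builds its functions with a pattern-matching lambda, which agrees with x ∷ᵛ f
    -- only pointwise.
    sumℕ-allFuns-suc : ∀ {k} (h : (Fin (suc k) → A) → ℕ) → (∀ {f g} → f ≗ g → h f ≡ h g) →
      sumℕ h (allFuns (suc k) xs) ≡ sumℕ (λ x → sumℕ (λ f → h (x ∷ᵛ f)) (allFuns k xs)) xs
    sumℕ-allFuns-suc {k} h h-cong =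
      trans (sumℕ-concatMap h _ xs)
            (sumℕ-cong xs (λ x → trans (sumℕ-map h _ (allFuns k xs))
                                       (sumℕ-cong (allFuns k xs) (λ f → h-cong λ { zero → refl ; (suc i) → refl }))))

    count-allFuns-suc : ∀ {k} (p : (Fin (suc k) → A) → Bool) → (∀ {f g} → f ≗ g → p f ≡ p g) →
      count p (allFuns (suc k) xs) ≡ sumℕ (λ x → count (λ f → p (x ∷ᵛ f)) (allFuns k xs)) xs
    count-allFuns-suc {k} p p-cong =
      trans (count≡sumℕ p (allFuns (suc k) xs))
            (trans (sumℕ-allFuns-suc (𝟙 ∘ p) (cong 𝟙 ∘ p-cong))
                   (sumℕ-cong xs (λ x → sym (count≡sumℕ _ (allFuns k xs)))))

    count-allFuns-+ : ∀ k l (p : (Fin k → A) → Bool) (p′ : (Fin l → A) → Bool) →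
      (∀ {f g} → f ≗ g → p f ≡ p g) → (∀ {f g} → f ≗ g → p′ f ≡ p′ g) →
      count (λ f → p (f ∘ (_↑ˡ l)) ∧ p′ (f ∘ (k ↑ʳ_))) (allFuns (k + l) xs) ≡
      count p (allFuns k xs) * count p′ (allFuns l xs)
    count-allFuns-+ zero l p p′ p-cong p′-cong =
      trans (count-cong (allFuns l xs) (λ f → cong (_∧ p′ f) (p-cong λ ()))) (count-∧ˡ (p (λ ())) p′ (allFuns l xs))
    count-allFuns-+ (suc k) l p p′ p-cong p′-cong = begin
      count (λ f → p (f ∘ (_↑ˡ l)) ∧ p′ (f ∘ (suc k ↑ʳ_))) (allFuns (suc k + l) xs)
        ≡⟨ count-allFuns-suc _ (λ f≗g → cong₂ _∧_ (p-cong (f≗g ∘ (_↑ˡ l))) (p′-cong (f≗g ∘ (suc k ↑ʳ_)))) ⟩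
      sumℕ (λ x → count (λ f → p ((x ∷ᵛ f) ∘ (_↑ˡ l)) ∧ p′ (f ∘ (k ↑ʳ_))) (allFuns (k + l) xs)) xs
        ≡⟨ sumℕ-cong xs (λ x → count-cong (allFuns (k + l) xs) (λ f →
             cong (_∧ p′ (f ∘ (k ↑ʳ_))) (p-cong λ { zero → refl ; (suc i) → refl }))) ⟩
      sumℕ (λ x → count (λ f → p (x ∷ᵛ (f ∘ (_↑ˡ l))) ∧ p′ (f ∘ (k ↑ʳ_))) (allFuns (k + l) xs)) xs
        ≡⟨ sumℕ-cong xs (λ x → count-allFuns-+ k l (p ∘ (x ∷ᵛ_)) p′
             (λ f≗g → p-cong λ { zero → refl ; (suc i) → f≗g i }) p′-cong) ⟩
      sumℕ (λ x → count (p ∘ (x ∷ᵛ_)) (allFuns k xs) * count p′ (allFuns l xs)) xs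
        ≡⟨ sumℕ-*ʳ (count p′ (allFuns l xs)) _ xs ⟩
      sumℕ (λ x → count (p ∘ (x ∷ᵛ_)) (allFuns k xs)) xs * count p′ (allFuns l xs)
        ≡⟨ cong (_* count p′ (allFuns l xs)) (count-allFuns-suc p p-cong) ⟨
      count p (allFuns (suc k) xs) * count p′ (allFuns l xs)
        ∎
      where open ≡-Reasoning

  module _ {a} {A : Set a} where

    count-tabulate-≡0 : ∀ {k} (g : Fin k → A) (p : A → Bool) → (∀ j → p (g j) ≡ false) →
                        count p (tabulate g) ≡ 0
    count-tabulate-≡0 {zero}  g p ¬pg = refl
    count-tabulate-≡0 {suc k} g p ¬pg rewrite ¬pg zero = count-tabulate-≡0 (g ∘ suc) p (¬pg ∘ suc)

    count-tabulate-≡1 : ∀ {k} (g : Fin k → A) (p : A → Bool) i → (∀ j → p (g j) ≡ does (i Fin.≟ j)) →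
                        count p (tabulate g) ≡ 1
    count-tabulate-≡1 g p zero    pg rewrite pg zero = cong suc (count-tabulate-≡0 (g ∘ suc) p (pg ∘ suc))
    count-tabulate-≡1 g p (suc i) pg rewrite pg zero = count-tabulate-≡1 (g ∘ suc) p i (pg ∘ suc)

  length-allFuns : ∀ {a} {A : Set a} k (xs : List A) → length (allFuns k xs) ≡ length xs ^ k
  length-allFuns zero    xs = refl
  length-allFuns (suc k) xs = begin
    length (allFuns (suc k) xs)                                 ≡⟨ count-true (allFuns (suc k) xs) ⟨
    count (const true) (allFuns (suc k) xs)                     ≡⟨ count-allFuns-suc xs (const true) (λ _ → refl) ⟩
    sumℕ (λ _ → count (const true) (allFuns k xs)) xs           ≡⟨ sumℕ-const _ xs ⟩
    length xs * count (const true) (allFuns k xs)               ≡⟨ cong (length xs *_) (trans (count-true (allFuns k xs)) (length-allFuns k xs)) ⟩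
    length xs * length xs ^ k                                   ∎
    where open ≡-Reasoning


module Enumerations where

  open import Data.Bool using (Bool; true; false; not; _∧_; T)
  open import Data.Bool.Properties using (T-∧)
  open import Data.Empty using (⊥-elim)
  open import Data.Fin using (Fin; zero; suc)
  open import Data.List using (List; length; cartesianProduct)
  open import Data.Nat using (ℕ; zero; suc; _+_; _*_; _≤_; _<_; z≤n; s≤s)
  open import Data.Nat.Properties using (≤-antisym; ≤-reflexive; +-comm; *-identityˡ; *-identityʳ; *-comm; _≤?_; <⇒≱; module ≤-Reasoning)
  open import Data.Product using (_×_; _,_; ∃)
  open import Data.Product.Relation.Binary.Pointwise.NonDependent using (×-decSetoid)
  open import Data.Unit using (tt)
  open import Data.Vec.Functional.Relation.Binary.Pointwise.Properties using () renaming (decSetoid to pointwiseDecSetoid)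
  open import Function using (_∘_; const)
  open import Function.Bundles using (Equivalence; mk⇔)
  open import Level using (_⊔_) renaming (suc to lsuc)
  open import Relation.Binary.Bundles using (DecSetoid)
  open import Relation.Binary.Core using (_Preserves_⟶_)
  open import Relation.Binary.PropositionalEquality as ≡ using (_≡_; cong; subst; subst₂; module ≡-Reasoning)
  open import Relation.Nullary using (¬_; does; yes; no)
  open import Relation.Nullary.Decidable using (decidable-stable; does-⇔)
  open import Defs using (count; allFuns)
  open Counting

  module _ {c ℓ} (S : DecSetoid c ℓ) where
    open DecSetoid S

    ≟-congʳ : ∀ x {y z} → y ≈ z → does (x ≟ y) ≡ does (x ≟ z)
    ≟-congʳ x y≈z = does-⇔ (mk⇔ (λ x≈y → trans x≈y y≈z) (λ x≈z → trans x≈z (sym y≈z))) (x ≟ _) (x ≟ _)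

    ≟-congˡ : ∀ y {x z} → x ≈ z → does (x ≟ y) ≡ does (z ≟ y)
    ≟-congˡ y x≈z = does-⇔ (mk⇔ (trans (sym x≈z)) (trans x≈z)) (_ ≟ y) (_ ≟ y)

  record Enumeration c ℓ : Set (lsuc (c ⊔ ℓ)) where
    field
      decSetoid : DecSetoid c ℓ
    open DecSetoid decSetoid public

    _==_ : Carrier → Carrier → Bool
    x == y = does (x ≟ y)

    field
      elements    : List Carrier
      listed-once : ∀ x → count (x ==_) elements ≡ 1

  module _ {c ℓ} (E : Enumeration c ℓ) where
    open Enumeration E

    ==⇒≈ : ∀ {x y} → T (x == y) → x ≈ y
    ==⇒≈ {x} {y} x==y with x ≟ y
    ... | yes x≈y = x≈y

    ≈⇒== : ∀ {x y} → x ≈ y → T (x == y)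
    ≈⇒== {x} {y} x≈y with x ≟ y
    ... | yes _   = tt
    ... | no  x≉y = x≉y x≈y

    sumℕ-listed-once : ∀ x → sumℕ (𝟙 ∘ (x ==_)) elements ≡ 1
    sumℕ-listed-once x = ≡.trans (≡.sym (count≡sumℕ (x ==_) elements)) (listed-once x)

    ==-congʳ : ∀ x → (x ==_) Preserves _≈_ ⟶ _≡_
    ==-congʳ = ≟-congʳ decSetoid

    ==-congˡ : ∀ y → (_== y) Preserves _≈_ ⟶ _≡_
    ==-congˡ = ≟-congˡ decSetoid

    sumℕ-indicator : ∀ (h : Carrier → ℕ) → h Preserves _≈_ ⟶ _≡_ → ∀ x →
                     sumℕ (λ y → 𝟙 (x == y) * h y) elements ≡ h x
    sumℕ-indicator h h-cong x = begin
      sumℕ (λ y → 𝟙 (x == y) * h y) elements  ≡⟨ sumℕ-cong elements pick ⟩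
      sumℕ (λ y → 𝟙 (x == y) * h x) elements  ≡⟨ sumℕ-*ʳ (h x) (𝟙 ∘ (x ==_)) elements ⟩
      sumℕ (𝟙 ∘ (x ==_)) elements * h x       ≡⟨ cong (_* h x) (sumℕ-listed-once x) ⟩
      1 * h x                                 ≡⟨ *-identityˡ (h x) ⟩
      h x                                     ∎
      where
      open ≡-Reasoning
      pick : ∀ y → 𝟙 (x == y) * h y ≡ 𝟙 (x == y) * h x
      pick y with x ≟ y
      ... | yes x≈y = cong (_+ 0) (h-cong (sym x≈y))
      ... | no  _   = ≡.refl

    count-≤1 : ∀ (p : Carrier → Bool) → (∀ {y z} → T (p y) → T (p z) → y ≈ z) → count p elements ≤ 1
    count-≤1 p unique with count p elements in c≡
    ... | zero  = z≤n
    ... | suc _ with count-witness p elements (subst (0 <_) (≡.sym c≡) (s≤s z≤n))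
    ... | y , py = subst (_≤ 1) c≡ (subst (count p elements ≤_) (listed-once y)
                     (count-mono elements (λ z pz → ≈⇒== (unique py pz))))

    count-≥1 : ∀ (p : Carrier → Bool) → p Preserves _≈_ ⟶ _≡_ → ∀ {x} → T (p x) → 1 ≤ count p elements
    count-≥1 p p-cong {x} px = subst (_≤ count p elements) (listed-once x)
      (count-mono elements (λ y x==y → subst T (p-cong (==⇒≈ x==y)) px))

    suc-count-others : ∀ x → suc (count (not ∘ (x ==_)) elements) ≡ length elements
    suc-count-others x = ≡.trans (+-comm 1 _)
      (≡.trans (cong (count (not ∘ (x ==_)) elements +_) (≡.sym (listed-once x))) (count-not (x ==_) elements))

  module _ {c ℓ c′ ℓ′} (E : Enumeration c ℓ) (E′ : Enumeration c′ ℓ′) (φ : Enumeration.Carrier E → Enumeration.Carrier E′) where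
    private
      module E  = Enumeration E
      module E′ = Enumeration E′

    fibre : (E.Carrier → Bool) → E′.Carrier → E.Carrier → Bool
    fibre p y x = p x ∧ (φ x E′.== y)

    count-by-fibres : ∀ (p : E.Carrier → Bool) →
      count p E.elements ≡ sumℕ (λ y → count (fibre p y) E.elements) E′.elements
    count-by-fibres p = begin
      count p E.elements
        ≡⟨ count≡sumℕ p E.elements ⟩
      sumℕ (λ x → 𝟙 (p x)) E.elements
        ≡⟨ sumℕ-cong E.elements (λ x → ≡.sym (≡.trans (sumℕ-*ˡ (𝟙 (p x)) _ E′.elements)
              (≡.trans (cong (𝟙 (p x) *_) (sumℕ-listed-once E′ (φ x))) (*-identityʳ _)))) ⟩
      sumℕ (λ x → sumℕ (λ y → 𝟙 (p x) * 𝟙 (φ x E′.== y)) E′.elements) E.elements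
        ≡⟨ sumℕ-comm _ E.elements E′.elements ⟩
      sumℕ (λ y → sumℕ (λ x → 𝟙 (p x) * 𝟙 (φ x E′.== y)) E.elements) E′.elements
        ≡⟨ sumℕ-cong E′.elements (λ y → ≡.trans (sumℕ-cong E.elements (λ x → ≡.sym (𝟙-∧ (p x) _)))
                                                (≡.sym (count≡sumℕ _ E.elements))) ⟩
      sumℕ (λ y → count (fibre p y) E.elements) E′.elements
        ∎
      where open ≡-Reasoning

    sumℕ-by-fibres : ∀ (h : E′.Carrier → ℕ) → h Preserves E′._≈_ ⟶ _≡_ →
      sumℕ (λ y → h y * count (λ x → φ x E′.== y) E.elements) E′.elements ≡ sumℕ (h ∘ φ) E.elements
    sumℕ-by-fibres h h-cong = begin
      sumℕ (λ y → h y * count (λ x → φ x E′.== y) E.elements) E′.elements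
        ≡⟨ sumℕ-cong E′.elements (λ y → ≡.trans (cong (h y *_) (count≡sumℕ _ E.elements)) (≡.sym (sumℕ-*ˡ (h y) _ E.elements))) ⟩
      sumℕ (λ y → sumℕ (λ x → h y * 𝟙 (φ x E′.== y)) E.elements) E′.elements
        ≡⟨ sumℕ-comm _ E′.elements E.elements ⟩
      sumℕ (λ x → sumℕ (λ y → h y * 𝟙 (φ x E′.== y)) E′.elements) E.elements
        ≡⟨ sumℕ-cong E.elements (λ x → ≡.trans (sumℕ-cong E′.elements (λ y → *-comm (h y) _)) (sumℕ-indicator E′ h h-cong (φ x))) ⟩
      sumℕ (h ∘ φ) E.elements
        ∎
      where open ≡-Reasoning

    count-≤-injection : ∀ (p : E.Carrier → Bool) (p′ : E′.Carrier → Bool) → p′ Preserves E′._≈_ ⟶ _≡_ →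
      (∀ {x} → T (p x) → T (p′ (φ x))) →
      (∀ {x y} → T (p x) → T (p y) → φ x E′.≈ φ y → x E.≈ y) →
      count p E.elements ≤ count p′ E′.elements
    count-≤-injection p p′ p′-cong p⇒p′φ φ-injective = begin
      count p E.elements                                          ≡⟨ count-by-fibres p ⟩
      sumℕ (λ y → count (fibre p y) E.elements) E′.elements       ≤⟨ sumℕ-mono E′.elements fibre-≤ ⟩
      sumℕ (𝟙 ∘ p′) E′.elements                                   ≡⟨ count≡sumℕ p′ E′.elements ⟨
      count p′ E′.elements                                        ∎
      where
      open ≤-Reasoning
      fibre-≤ : ∀ y → count (fibre p y) E.elements ≤ 𝟙 (p′ y)
      fibre-≤ y with p′ y in p′y
      ... | true  = count-≤1 E (fibre p y) (λ fx fz →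
                      let px , φx==y = Equivalence.to T-∧ fx
                          pz , φz==y = Equivalence.to T-∧ fz
                      in φ-injective px pz (E′.trans (==⇒≈ E′ φx==y) (E′.sym (==⇒≈ E′ φz==y))))
      ... | false = ≤-reflexive (count-≡0 E.elements not-in-fibre)
        where
        not-in-fibre : ∀ x → fibre p y x ≡ false
        not-in-fibre x with p x in px | φ x E′.≟ y
        ... | false | _        = ≡.refl
        ... | true  | no  _    = ≡.refl
        ... | true  | yes φx≈y = ⊥-elim (subst T (≡.trans (p′-cong φx≈y) p′y) (p⇒p′φ (subst T (≡.sym px) tt)))

    -- Surjectivity is only needed up to double negation, as the conclusion is decidable.
    count-≥-surjection : ∀ (p : E.Carrier → Bool) (p′ : E′.Carrier → Bool) →
      p Preserves E._≈_ ⟶ _≡_ → φ Preserves E._≈_ ⟶ E′._≈_ →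
      (∀ {y} → T (p′ y) → ¬ ¬ ∃ λ x → T (p x) × φ x E′.≈ y) →
      count p′ E′.elements ≤ count p E.elements
    count-≥-surjection p p′ p-cong φ-cong p′⊆image = begin
      count p′ E′.elements                                        ≡⟨ count≡sumℕ p′ E′.elements ⟩
      sumℕ (𝟙 ∘ p′) E′.elements                                   ≤⟨ sumℕ-mono E′.elements fibre-≥ ⟩
      sumℕ (λ y → count (fibre p y) E.elements) E′.elements       ≡⟨ count-by-fibres p ⟨
      count p E.elements                                          ∎
      where
      open ≤-Reasoning
      fibre-≥ : ∀ y → 𝟙 (p′ y) ≤ count (fibre p y) E.elements
      fibre-≥ y with p′ y in p′y
      ... | false = z≤n
      ... | true  = decidable-stable (1 ≤? count (fibre p y) E.elements) λ fibre-empty →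
                      p′⊆image (subst T (≡.sym p′y) tt) λ (x , px , φx≈y) →
                        fibre-empty (count-≥1 E (fibre p y)
                          (λ x≈z → ≡.cong₂ _∧_ (p-cong x≈z) (==-congˡ E′ y (φ-cong x≈z)))
                          (Equivalence.from T-∧ (px , ≈⇒== E′ φx≈y)))

    count-bijection : ∀ (p : E.Carrier → Bool) (p′ : E′.Carrier → Bool) →
      p Preserves E._≈_ ⟶ _≡_ → p′ Preserves E′._≈_ ⟶ _≡_ → φ Preserves E._≈_ ⟶ E′._≈_ →
      (∀ {x} → T (p x) → T (p′ (φ x))) →
      (∀ {x y} → T (p x) → T (p y) → φ x E′.≈ φ y → x E.≈ y) →
      (∀ {y} → T (p′ y) → ¬ ¬ ∃ λ x → T (p x) × φ x E′.≈ y) →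
      count p E.elements ≡ count p′ E′.elements
    count-bijection p p′ p-cong p′-cong φ-cong p⇒p′φ φ-injective p′⊆image =
      ≤-antisym (count-≤-injection p p′ p′-cong p⇒p′φ φ-injective)
                (count-≥-surjection p p′ p-cong φ-cong p′⊆image)

    length-≤-injection : (∀ {x y} → φ x E′.≈ φ y → x E.≈ y) → length E.elements ≤ length E′.elements
    length-≤-injection φ-injective =
      subst₂ _≤_ (count-true E.elements) (count-true E′.elements)
        (count-≤-injection (const true) (const true) (λ _ → ≡.refl) (λ _ → tt) (λ _ _ → φ-injective))

  module _ {c ℓ} (E : Enumeration c ℓ) (φ : Enumeration.Carrier E → Enumeration.Carrier E) where
    open Enumeration E

    injective⇒surjective : (∀ {x y} → φ x ≈ φ y → x ≈ y) → ∀ y → ¬ ¬ ∃ λ x → φ x ≈ y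
    injective⇒surjective φ-injective y y∉image = <⇒≱ (≤-reflexive (suc-count-others E y))
      (subst (_≤ count (not ∘ (y ==_)) elements) (count-true elements)
        (count-≤-injection E E φ (const true) (not ∘ (y ==_)) (cong not ∘ ==-congʳ E y)
          (λ {x} _ → y≢φx x) (λ _ _ → φ-injective)))
      where
      y≢φx : ∀ x → T (not (y == φ x))
      y≢φx x with y ≟ φ x
      ... | yes y≈φx = y∉image (x , sym y≈φx)
      ... | no  _    = tt

  module _ {c ℓ} (E : Enumeration c ℓ) where
    open Enumeration E

    private
      _==ᵛ_ : ∀ {k} → (Fin k → Carrier) → (Fin k → Carrier) → Bool
      f ==ᵛ g = does (DecSetoid._≟_ (pointwiseDecSetoid decSetoid _) f g)

      listed-once-allFuns : ∀ k (f : Fin k → Carrier) → count (λ g → f ==ᵛ g) (allFuns k elements) ≡ 1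
      listed-once-allFuns zero    f = ≡.refl
      listed-once-allFuns (suc k) f = begin
        count (λ g → f ==ᵛ g) (allFuns (suc k) elements)
          ≡⟨ count-allFuns-suc elements _ (λ g≗h → ≟-congʳ (pointwiseDecSetoid decSetoid (suc k)) f (reflexive ∘ g≗h)) ⟩
        sumℕ (λ x → count (λ g → (f zero == x) ∧ (f ∘ suc) ==ᵛ g) (allFuns k elements)) elements
          ≡⟨ sumℕ-cong elements (λ x → ≡.trans (count-∧ˡ (f zero == x) _ (allFuns k elements))
                                              (cong (𝟙 (f zero == x) *_) (listed-once-allFuns k (f ∘ suc)))) ⟩
        sumℕ (λ x → 𝟙 (f zero == x) * 1) elements
          ≡⟨ sumℕ-cong elements (λ x → *-identityʳ _) ⟩
        sumℕ (𝟙 ∘ (f zero ==_)) elements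
          ≡⟨ sumℕ-listed-once E (f zero) ⟩
        1 ∎
        where open ≡-Reasoning

    vectors : ℕ → Enumeration c ℓ
    vectors k = record
      { decSetoid   = pointwiseDecSetoid decSetoid k
      ; elements    = allFuns k elements
      ; listed-once = listed-once-allFuns k
      }

  _×ₑ_ : ∀ {c ℓ c′ ℓ′} → Enumeration c ℓ → Enumeration c′ ℓ′ → Enumeration (c ⊔ c′) (ℓ ⊔ ℓ′)
  E ×ₑ E′ = record
    { decSetoid   = ×-decSetoid E.decSetoid E′.decSetoid
    ; elements    = cartesianProduct E.elements E′.elements
    ; listed-once = λ (x , y) → ≡.trans (count-cartesianProduct-∧ (x E.==_) (y E′.==_) E.elements E′.elements)
                                        (≡.cong₂ _*_ (E.listed-once x) (E′.listed-once y))
    }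
    where
    module E  = Enumeration E
    module E′ = Enumeration E′


module Matrices {c ℓ} (F : FiniteField c ℓ) where

  open import Data.Bool using (Bool; if_then_else_)
  open import Data.Fin using (Fin; zero; suc)
  import Data.Fin.Properties as Fin
  open import Data.Nat using (ℕ; zero; suc)
  open import Data.Product using (_,_)
  open import Function using (_∘_)
  open import Function.Bundles using (mk⇔)
  open import Relation.Binary.Core using (_Preserves_⟶_)
  open import Relation.Binary.PropositionalEquality as ≡ using (_≡_; _≗_)
  import Relation.Binary.Reasoning.Setoid as SetoidReasoning
  open import Relation.Nullary using (does)
  open import Relation.Nullary.Decidable using (does-⇔)
  import Defs as D
  open import Defs using (count)
  open Counting
  open Enumerations

  open FiniteField F hiding (zero)
  open import Relation.Binary.Reasoning.Setoid setoid
  open import Algebra.Properties.Ring ring using ([y-z]x≈yx-zx)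
  open import Algebra.Properties.AbelianGroup +-abelianGroup using (⁻¹-∙-comm)
  open import Algebra.Properties.Group +-group using (x∙y⁻¹≈ε⇒x≈y; x≈y⇒x∙y⁻¹≈ε; ε⁻¹≈ε)
  open import Algebra.Properties.CommutativeSemigroup +-commutativeSemigroup using () renaming (interchange to +-interchange)

  scalars : Enumeration c ℓ
  scalars = record
    { decSetoid   = record { isDecEquivalence = record { isEquivalence = isEquivalence ; _≟_ = _≟_ } }
    ; elements    = D.elems F
    ; listed-once = λ x → let i , eᵢ≈x = elem-sur x in
        count-tabulate-≡1 elem _ i (λ j → does-⇔ (mk⇔ (λ x≈eⱼ → elem-inj i j (trans eᵢ≈x x≈eⱼ))
                                                       (λ { ≡.refl → sym eᵢ≈x }))
                                                  (x ≟ elem j) (i Fin.≟ j))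
    }

  Matrix : ℕ → ℕ → Set c
  Matrix = D.Mat F

  matrices : ℕ → ℕ → Enumeration c ℓ
  matrices m n = vectors (vectors scalars n) m

  _==ᴹ_ : ∀ {m n} → Matrix m n → Matrix m n → Bool
  _==ᴹ_ {m} {n} = Enumeration._==_ (matrices m n)

  module ≈ᴹ-Reasoning {m n} = SetoidReasoning (Enumeration.setoid (matrices m n))

  ∑ : (k : ℕ) → (Fin k → Carrier) → Carrier
  ∑ = D.Σ[_]_ F

  syntax ∑ k (λ i → e) = ∑[ i < k ] e

  ∑-0# : ∀ k → ∑[ i < k ] 0# ≈ 0#
  ∑-0# zero    = refl
  ∑-0# (suc k) = trans (+-identityˡ _) (∑-0# k)

  ∑-cong : ∀ {k} {f g : Fin k → Carrier} → (∀ i → f i ≈ g i) → ∑ k f ≈ ∑ k g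
  ∑-cong {zero}  f≈g = refl
  ∑-cong {suc k} f≈g = +-cong (f≈g zero) (∑-cong (f≈g ∘ suc))

  ∑-distrib-+ : ∀ {k} (f g : Fin k → Carrier) → ∑[ i < k ] (f i + g i) ≈ ∑ k f + ∑ k g
  ∑-distrib-+ {zero}  f g = sym (+-identityˡ 0#)
  ∑-distrib-+ {suc k} f g = trans (+-congˡ (∑-distrib-+ (f ∘ suc) (g ∘ suc))) (+-interchange _ _ _ _)

  ∑-neg : ∀ {k} (f : Fin k → Carrier) → ∑[ i < k ] (- f i) ≈ - ∑ k f
  ∑-neg {zero}  f = sym ε⁻¹≈ε
  ∑-neg {suc k} f = trans (+-congˡ (∑-neg (f ∘ suc))) (⁻¹-∙-comm _ _)

  ∑-distrib-- : ∀ {k} (f g : Fin k → Carrier) → ∑[ i < k ] (f i - g i) ≈ ∑ k f - ∑ k g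
  ∑-distrib-- f g = trans (∑-distrib-+ f (-_ ∘ g)) (+-congˡ (∑-neg g))

  *-distribˡ-∑ : ∀ {k} a (f : Fin k → Carrier) → a * ∑ k f ≈ ∑[ i < k ] (a * f i)
  *-distribˡ-∑ {zero}  a f = zeroʳ a
  *-distribˡ-∑ {suc k} a f = trans (distribˡ a _ _) (+-congˡ (*-distribˡ-∑ a (f ∘ suc)))

  *-distribʳ-∑ : ∀ {k} a (f : Fin k → Carrier) → ∑ k f * a ≈ ∑[ i < k ] (f i * a)
  *-distribʳ-∑ a f = trans (*-comm _ a) (trans (*-distribˡ-∑ a f) (∑-cong (λ i → *-comm a (f i))))

  ∑-comm : ∀ {k l} (f : Fin k → Fin l → Carrier) → ∑[ i < k ] ∑[ j < l ] f i j ≈ ∑[ j < l ] ∑[ i < k ] f i j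
  ∑-comm {zero}  {l} f = sym (∑-0# l)
  ∑-comm {suc k} {l} f = trans (+-congˡ (∑-comm (f ∘ suc))) (sym (∑-distrib-+ {l} _ _))

  δ : ∀ {k} → Fin k → Fin k → Carrier
  δ i j = if does (i Fin.≟ j) then 1# else 0#

  ∑-δˡ : ∀ {k} i (f : Fin k → Carrier) → ∑[ j < k ] (δ i j * f j) ≈ f i
  ∑-δˡ {suc k} zero f = trans (+-cong (*-identityˡ (f zero)) (trans (∑-cong (λ j → zeroˡ (f (suc j)))) (∑-0# k))) (+-identityʳ _)
  ∑-δˡ (suc i) f = trans (+-cong (zeroˡ (f zero)) (∑-δˡ i (f ∘ suc))) (+-identityˡ _)

  δ-sym : ∀ {k} (i j : Fin k) → δ i j ≡ δ j i
  δ-sym i j = ≡.cong (if_then 1# else 0#) (does-⇔ (mk⇔ ≡.sym ≡.sym) (i Fin.≟ j) (j Fin.≟ i))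

  ∑-δʳ : ∀ {k} i (f : Fin k → Carrier) → ∑[ j < k ] (f j * δ j i) ≈ f i
  ∑-δʳ {k} i f = trans (∑-cong {k} (λ j → trans (*-comm _ _) (*-congʳ (reflexive (δ-sym j i))))) (∑-δˡ i f)

  I : ∀ k → Matrix k k
  I k = δ

  _⊗_ : ∀ {m r n} → Matrix m r → Matrix r n → Matrix m n
  _⊗_ = D._⊗_ F

  infix 4 _≈ᴹ_
  _≈ᴹ_ : ∀ {m n} → Matrix m n → Matrix m n → Set ℓ
  _≈ᴹ_ = D._≈M_ F

  ≈ᴹ-refl : ∀ {m n} {A : Matrix m n} → A ≈ᴹ A
  ≈ᴹ-refl i j = refl

  ≈ᴹ-sym : ∀ {m n} {A B : Matrix m n} → A ≈ᴹ B → B ≈ᴹ A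
  ≈ᴹ-sym A≈B i j = sym (A≈B i j)

  ≈ᴹ-trans : ∀ {m n} {A B C : Matrix m n} → A ≈ᴹ B → B ≈ᴹ C → A ≈ᴹ C
  ≈ᴹ-trans A≈B B≈C i j = trans (A≈B i j) (B≈C i j)

  ≗⇒≈ᴹ : ∀ {m n} {A B : Matrix m n} → A ≗ B → A ≈ᴹ B
  ≗⇒≈ᴹ A≗B i j = reflexive (≡.cong (λ row → row j) (A≗B i))

  ⊗-cong : ∀ {m r n} {A A′ : Matrix m r} {B B′ : Matrix r n} → A ≈ᴹ A′ → B ≈ᴹ B′ → A ⊗ B ≈ᴹ A′ ⊗ B′
  ⊗-cong {r = r} A≈A′ B≈B′ i j = ∑-cong {r} (λ k → *-cong (A≈A′ i k) (B≈B′ k j))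

  ⊗-congˡ : ∀ {m r n} (A : Matrix m r) {B B′ : Matrix r n} → B ≈ᴹ B′ → A ⊗ B ≈ᴹ A ⊗ B′
  ⊗-congˡ A = ⊗-cong (≈ᴹ-refl {A = A})

  ⊗-congʳ : ∀ {m r n} {A A′ : Matrix m r} (B : Matrix r n) → A ≈ᴹ A′ → A ⊗ B ≈ᴹ A′ ⊗ B
  ⊗-congʳ B A≈A′ = ⊗-cong A≈A′ (≈ᴹ-refl {A = B})

  ⊗-assoc : ∀ {m r s n} (A : Matrix m r) (B : Matrix r s) (C : Matrix s n) → (A ⊗ B) ⊗ C ≈ᴹ A ⊗ (B ⊗ C)
  ⊗-assoc {r = r} {s} A B C i j = begin
    ∑[ k < s ] (∑[ l < r ] (A i l * B l k) * C k j)  ≈⟨ ∑-cong {s} (λ k → *-distribʳ-∑ (C k j) (λ l → A i l * B l k)) ⟩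
    ∑[ k < s ] ∑[ l < r ] (A i l * B l k * C k j)    ≈⟨ ∑-comm (λ k l → A i l * B l k * C k j) ⟩
    ∑[ l < r ] ∑[ k < s ] (A i l * B l k * C k j)    ≈⟨ ∑-cong {r} (λ l → ∑-cong {s} (λ k → *-assoc _ _ _)) ⟩
    ∑[ l < r ] ∑[ k < s ] (A i l * (B l k * C k j))  ≈⟨ ∑-cong {r} (λ l → *-distribˡ-∑ (A i l) (λ k → B l k * C k j)) ⟨
    ∑[ l < r ] (A i l * ∑[ k < s ] (B l k * C k j))  ∎

  ⊗-identityˡ : ∀ {m n} (A : Matrix m n) → I m ⊗ A ≈ᴹ A
  ⊗-identityˡ A i j = ∑-δˡ i (λ k → A k j)

  ⊗-identityʳ : ∀ {m n} (A : Matrix m n) → A ⊗ I n ≈ᴹ A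
  ⊗-identityʳ A i j = ∑-δʳ j (A i)

  _ᵀ : ∀ {m n} → Matrix m n → Matrix n m
  (A ᵀ) i j = A j i

  LinIndep-injective : ∀ {m k} {v : Fin k → Fin m → Carrier} → D.LinIndep F v →
    ∀ {a b : Fin k → Carrier} → (∀ i → ∑[ j < k ] (a j * v j i) ≈ ∑[ j < k ] (b j * v j i)) → ∀ j → a j ≈ b j
  LinIndep-injective {k = k} {v} independent {a} {b} a≈b j = x∙y⁻¹≈ε⇒x≈y _ _ (independent (λ j → a j - b j) (λ i → begin
    ∑[ j < k ] ((a j - b j) * v j i)                      ≈⟨ ∑-cong {k} (λ j → [y-z]x≈yx-zx (v j i) (a j) (b j)) ⟩
    ∑[ j < k ] (a j * v j i - b j * v j i)                ≈⟨ ∑-distrib-- (λ j → a j * v j i) (λ j → b j * v j i) ⟩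
    ∑[ j < k ] (a j * v j i) - ∑[ j < k ] (b j * v j i)   ≈⟨ x≈y⇒x∙y⁻¹≈ε (a≈b i) ⟩
    0#                                                    ∎) j)

  ⊗-cancelˡ : ∀ {m r n} {X : Matrix m r} → D.LinIndep F (X ᵀ) → ∀ {A B : Matrix r n} → X ⊗ A ≈ᴹ X ⊗ B → A ≈ᴹ B
  ⊗-cancelˡ {r = r} independent {A} {B} XA≈XB j l = LinIndep-injective independent {a = λ k → A k l} {b = λ k → B k l}
    (λ i → trans (∑-cong {r} (λ k → *-comm _ _)) (trans (XA≈XB i l) (∑-cong {r} (λ k → *-comm _ _)))) j

  HasIndepCols-cong : ∀ {m n k} {N N′ : Matrix m n} → N ≈ᴹ N′ → D.HasIndepCols F k N → D.HasIndepCols F k N′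
  HasIndepCols-cong {k = k} N≈N′ (sel , independent) =
    sel , λ a a·N′≈0 → independent a (λ i → trans (∑-cong {k} (λ j → *-congˡ (N≈N′ i (sel j)))) (a·N′≈0 i))

  HasRank-cong : ∀ {m n r} {N N′ : Matrix m n} → N ≈ᴹ N′ → D.HasRank F r N → D.HasRank F r N′
  HasRank-cong N≈N′ (indep , ¬indep) = HasIndepCols-cong N≈N′ indep , ¬indep ∘ HasIndepCols-cong (≈ᴹ-sym N≈N′)

  count-ᵀ : ∀ {m n} (p : Matrix n m → Bool) → p Preserves _≈ᴹ_ ⟶ _≡_ →
            count (p ∘ _ᵀ) (D.allMats F m n) ≡ count p (D.allMats F n m)
  count-ᵀ p p-cong = count-bijection (matrices _ _) (matrices _ _) _ᵀ (p ∘ _ᵀ) p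
    (λ A≈B → p-cong (λ i j → A≈B j i)) p-cong (λ A≈B i j → A≈B j i) (λ pAᵀ → pAᵀ)
    (λ _ _ Aᵀ≈Bᵀ i j → Aᵀ≈Bᵀ j i) (λ {B} pB ¬preimage → ¬preimage (B ᵀ , pB , ≈ᴹ-refl))


module Rank {c ℓ} (F : FiniteField c ℓ) where

  open import Data.Empty using (⊥-elim)
  open import Data.Fin using (Fin; zero; suc)
  open import Data.Fin.Properties using (sequence)
  open import Data.List using (length)
  open import Data.List.Properties using (length-tabulate)
  open import Data.Nat as ℕ using (ℕ; zero; suc; _^_; z≤n; s≤s)
  open import Data.Nat.Properties using (≤-trans; ^-monoʳ-<; ^-*-assoc; n<1+n; <⇒≱) renaming (*-comm to ℕ-*-comm)
  open import Data.Product using (Σ; ∃; _×_; _,_; proj₁; proj₂)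
  open import Data.Vec.Functional using () renaming (_∷_ to _∷ᵛ_)
  open import Effect.Monad using (RawMonad)
  open import Function using (_∘_)
  open import Relation.Binary.PropositionalEquality as ≡ using (_≡_; _≢_)
  open import Relation.Nullary using (¬_)
  open import Relation.Nullary.Decidable using (decidable-stable)
  open import Relation.Nullary.Negation using (¬¬-map; ¬¬-Monad)
  import Defs as D
  open Counting
  open Enumerations
  open Matrices F

  open FiniteField F hiding (zero)
  open import Relation.Binary.Reasoning.Setoid setoid
  open import Algebra.Properties.CommutativeSemigroup *-commutativeSemigroup using (x∙yz≈y∙xz)
  open import Algebra.Properties.Ring ring using (-‿distribʳ-*)
  open import Algebra.Properties.Group +-group using (inverseˡ-unique)

  2≤q : 2 ℕ.≤ q
  2≤q with elem-sur 0# | elem-sur 1#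
  ... | i₀ , e₀≈0 | i₁ , e₁≈1 = distinct⇒2≤ (λ i₀≡i₁ → 0≉1 (trans (sym e₀≈0) (trans (reflexive (≡.cong elem i₀≡i₁)) e₁≈1)))
    where
    distinct⇒2≤ : ∀ {n} {i j : Fin n} → i ≢ j → 2 ℕ.≤ n
    distinct⇒2≤ {suc zero}    {zero} {zero} i≢j = ⊥-elim (i≢j ≡.refl)
    distinct⇒2≤ {suc (suc n)} i≢j = s≤s (s≤s z≤n)

  selectCols : ∀ {m n k} → Matrix m n → (Fin k → Fin n) → Matrix m k
  selectCols N sel i j = N i (sel j)

  instance
    q-nonZero : ℕ.NonZero q
    q-nonZero = ℕ.>-nonZero (≤-trans (s≤s z≤n) 2≤q)

  length-vectors : ∀ k → length (Enumeration.elements (vectors scalars k)) ≡ q ^ k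
  length-vectors k = ≡.trans (length-allFuns k (D.elems F)) (≡.cong (_^ k) (length-tabulate elem))

  length-matrices : ∀ m n → length (D.allMats F m n) ≡ q ^ (m ℕ.* n)
  length-matrices m n = ≡.trans (length-allFuns m _) (≡.trans (≡.cong (_^ m) (length-vectors n))
    (≡.trans (^-*-assoc q n m) (≡.cong (q ^_) (ℕ-*-comm n m))))

  ∑-⊗-selectCols : ∀ {m r n k} (X : Matrix m r) (Y : Matrix r n) (sel : Fin k → Fin n) (a : Fin k → Carrier) i →
    ∑[ j < k ] (a j * (X ⊗ Y) i (sel j)) ≈ ∑[ l < r ] (X i l * ∑[ j < k ] (a j * Y l (sel j)))
  ∑-⊗-selectCols {r = r} {k = k} X Y sel a i = begin
    ∑[ j < k ] (a j * ∑[ l < r ] (X i l * Y l (sel j)))   ≈⟨ ∑-cong {k} (λ j → *-distribˡ-∑ (a j) (λ l → X i l * Y l (sel j))) ⟩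
    ∑[ j < k ] ∑[ l < r ] (a j * (X i l * Y l (sel j)))   ≈⟨ ∑-cong {k} (λ j → ∑-cong {r} (λ l → x∙yz≈y∙xz (a j) (X i l) _)) ⟩
    ∑[ j < k ] ∑[ l < r ] (X i l * (a j * Y l (sel j)))   ≈⟨ ∑-comm (λ j l → X i l * (a j * Y l (sel j))) ⟩
    ∑[ l < r ] ∑[ j < k ] (X i l * (a j * Y l (sel j)))   ≈⟨ ∑-cong {r} (λ l → *-distribˡ-∑ (X i l) (λ j → a j * Y l (sel j))) ⟨
    ∑[ l < r ] (X i l * ∑[ j < k ] (a j * Y l (sel j)))   ∎

  -- a ↦ Y_sel a would be an injection from F^(r+1) into F^r.
  ⊗-¬HasIndepCols : ∀ {m r n} (X : Matrix m r) (Y : Matrix r n) → ¬ D.HasIndepCols F (suc r) (X ⊗ Y)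
  ⊗-¬HasIndepCols {r = r} X Y (sel , independent) = <⇒≱ (^-monoʳ-< q 2≤q (n<1+n r))
    (≡.subst₂ ℕ._≤_ (length-vectors (suc r)) (length-vectors r)
      (length-≤-injection (vectors scalars (suc r)) (vectors scalars r) image image-injective))
    where
    image : (Fin (suc r) → Carrier) → Fin r → Carrier
    image a l = ∑[ j < suc r ] (a j * Y l (sel j))
    image-injective : ∀ {a b} → (∀ l → image a l ≈ image b l) → ∀ j → a j ≈ b j
    image-injective {a} {b} a≈b = LinIndep-injective {v = selectCols (X ⊗ Y) sel ᵀ} independent λ i → begin
      ∑[ j < suc r ] (a j * (X ⊗ Y) i (sel j))   ≈⟨ ∑-⊗-selectCols X Y sel a i ⟩
      ∑[ l < r ] (X i l * image a l)             ≈⟨ ∑-cong {r} (λ l → *-congˡ (a≈b l)) ⟩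
      ∑[ l < r ] (X i l * image b l)             ≈⟨ ∑-⊗-selectCols X Y sel b i ⟨
      ∑[ j < suc r ] (b j * (X ⊗ Y) i (sel j))   ∎

  IdentityRows : ∀ {m r} → Matrix m r → Set ℓ
  IdentityRows {m} {r} X = Σ (Fin r → Fin m) λ ρ → ∀ i j → X (ρ i) j ≈ δ i j

  IdentityColumns : ∀ {r n} → Matrix r n → Set ℓ
  IdentityColumns {r} {n} Y = Σ (Fin r → Fin n) λ σ → ∀ i j → Y i (σ j) ≈ δ i j

  ⊗-HasRank : ∀ {m r n} {X : Matrix m r} {Y : Matrix r n} → IdentityRows X → IdentityColumns Y → D.HasRank F r (X ⊗ Y)
  ⊗-HasRank {r = r} {X = X} {Y} (ρ , Xρ≈I) (σ , Yσ≈I) = (σ , independent) , ⊗-¬HasIndepCols X Y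
    where
    XYσ≈X : ∀ i j → (X ⊗ Y) i (σ j) ≈ X i j
    XYσ≈X i j = trans (∑-cong {r} (λ k → *-congˡ (Yσ≈I k j))) (∑-δʳ j (X i))
    independent : D.LinIndep F (selectCols (X ⊗ Y) σ ᵀ)
    independent a a·XYσ≈0 l = begin
      a l                                     ≈⟨ ∑-δʳ l a ⟨
      ∑[ j < r ] (a j * δ j l)                ≈⟨ ∑-cong {r} (λ j → *-congˡ (reflexive (δ-sym j l))) ⟩
      ∑[ j < r ] (a j * δ l j)                ≈⟨ ∑-cong {r} (λ j → *-congˡ (trans (XYσ≈X (ρ l) j) (Xρ≈I l j))) ⟨
      ∑[ j < r ] (a j * (X ⊗ Y) (ρ l) (σ j))  ≈⟨ a·XYσ≈0 (ρ l) ⟩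
      0#                                      ∎

  ¬LinIndep⇒dependence : ∀ {m k} (v : Fin k → Fin m → Carrier) → ¬ D.LinIndep F v →
    ¬ ¬ ∃ λ a → (∀ i → ∑[ j < k ] (a j * v j i) ≈ 0#) × ∃ λ j → ¬ a j ≈ 0#
  ¬LinIndep⇒dependence v ¬independent ¬dependence = ¬independent λ a a·v≈0 j →
    decidable-stable (a j ≟ 0#) λ aⱼ≉0 → ¬dependence (a , a·v≈0 , j , aⱼ≉0)

  module _ {m n r} (N : Matrix m n) (sel : Fin r → Fin n)
           (independent : D.LinIndep F (selectCols N sel ᵀ))
           (maximal : ¬ D.HasIndepCols F (suc r) N) where

    column-in-span : ∀ l → ¬ ¬ ∃ λ y → ∀ i → N i l ≈ ∑[ k < r ] (N i (sel k) * y k)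
    column-in-span l ¬inSpan = ¬LinIndep⇒dependence (selectCols N (l ∷ᵛ sel) ᵀ)
      (λ independent′ → maximal (l ∷ᵛ sel , independent′))
      λ (a , a·v≈0 , j , aⱼ≉0) → ¬inSpan (express a a·v≈0 (a₀≉0 a a·v≈0 j aⱼ≉0))
      where
      rest : (Fin (suc r) → Carrier) → Fin m → Carrier
      rest a i = ∑[ k < r ] (a (suc k) * N i (sel k))

      a₀≉0 : ∀ a → (∀ i → a zero * N i l + rest a i ≈ 0#) → ∀ j → ¬ a j ≈ 0# → ¬ a zero ≈ 0#
      a₀≉0 a a·v≈0 j aⱼ≉0 a₀≈0 = aⱼ≉0 (all-zero j)
        where
        all-zero : ∀ j → a j ≈ 0#
        all-zero zero    = a₀≈0
        all-zero (suc k) = independent (a ∘ suc)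
          (λ i → trans (sym (+-identityˡ _)) (trans (+-congʳ (sym (trans (*-congʳ a₀≈0) (zeroˡ _)))) (a·v≈0 i))) k

      express : ∀ a → (∀ i → a zero * N i l + rest a i ≈ 0#) → ¬ a zero ≈ 0# →
              ∃ λ y → ∀ i → N i l ≈ ∑[ k < r ] (N i (sel k) * y k)
      express a a·v≈0 a₀≉0 = (λ k → - (w * a (suc k))) , λ i → begin
        N i l                                           ≈⟨ *-identityˡ _ ⟨
        1# * N i l                                      ≈⟨ *-congʳ w*a₀≈1 ⟨
        w * a zero * N i l                              ≈⟨ *-assoc _ _ _ ⟩
        w * (a zero * N i l)                            ≈⟨ *-congˡ (inverseˡ-unique _ _ (a·v≈0 i)) ⟩
        w * - rest a i                                  ≈⟨ -‿distribʳ-* w _ ⟨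
        - (w * rest a i)                                ≈⟨ -‿cong (*-distribˡ-∑ w (λ k → a (suc k) * N i (sel k))) ⟩
        - (∑[ k < r ] (w * (a (suc k) * N i (sel k))))  ≈⟨ ∑-neg {r} _ ⟨
        ∑[ k < r ] (- (w * (a (suc k) * N i (sel k))))  ≈⟨ ∑-cong {r} (λ k → rearrange w (a (suc k)) (N i (sel k))) ⟩
        ∑[ k < r ] (N i (sel k) * - (w * a (suc k)))    ∎
        where
        w = proj₁ (inverse (a zero) a₀≉0)
        w*a₀≈1 : w * a zero ≈ 1#
        w*a₀≈1 = trans (*-comm _ _) (proj₂ (inverse (a zero) a₀≉0))
        rearrange : ∀ w a x → - (w * (a * x)) ≈ x * - (w * a)
        rearrange w a x = trans (-‿cong (trans (sym (*-assoc w a x)) (*-comm _ x))) (-‿distribʳ-* x _)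

    rank-factorisation : ¬ ¬ ∃ λ (Y : Matrix r n) → N ≈ᴹ selectCols N sel ⊗ Y
    rank-factorisation = ¬¬-map (λ ys → (λ k l → proj₁ (ys l) k) , λ i l → proj₂ (ys l) i)
      (sequence (RawMonad.rawApplicative ¬¬-Monad) column-in-span)


module Fibres {c ℓ} (F : FiniteField c ℓ) (r : ℕ) where

  open import Data.Bool using (Bool)
  open import Data.Fin using (Fin)
  open import Data.List using (List)
  open import Data.Nat.Properties using () renaming (_≟_ to _≟ℕ_)
  open import Data.Product using (∃; _×_; _,_)
  open import Relation.Binary.PropositionalEquality as ≡ using (_≡_)
  open import Relation.Nullary using (¬_)
  open import Relation.Nullary.Decidable using (decidable-stable)
  open import Relation.Nullary.Negation using (¬¬-map)
  import Defs as D
  open import Defs using (count)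
  open Enumerations
  open Matrices F
  open Rank F

  open FiniteField F using (sym; trans)

  pairs : ℕ → ℕ → Enumeration c ℓ
  pairs m n = matrices m r ×ₑ matrices r n

  allPairs : ∀ m n → List (Matrix m r × Matrix r n)
  allPairs m n = Enumeration.elements (pairs m n)

  IsFactorisation : ∀ {m n} → Matrix m n → Matrix m r × Matrix r n → Bool
  IsFactorisation N (X , Y) = (X ⊗ Y) ==ᴹ N

  #factorisations : ∀ {m n} → Matrix m n → ℕ
  #factorisations {m} {n} N = count (IsFactorisation N) (allPairs m n)

  module _ {m n} {N : Matrix m n} (sel : Fin r → Fin n)
           (independent : D.LinIndep F (selectCols N sel ᵀ))
           (Y₀ : Matrix r n) (N≈X₀Y₀ : N ≈ᴹ selectCols N sel ⊗ Y₀) where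

    private
      X₀ : Matrix m r
      X₀ = selectCols N sel

    selectCols-Y₀≈I : selectCols Y₀ sel ≈ᴹ I r
    selectCols-Y₀≈I = ⊗-cancelˡ independent λ i j → trans (sym (N≈X₀Y₀ i (sel j))) (sym (⊗-identityʳ X₀ i j))

    factor : Matrix r r × Matrix r r → Matrix m r × Matrix r n
    factor (G , H) = X₀ ⊗ G , H ⊗ Y₀

    factor-factorises : ∀ {G H : Matrix r r} → G ⊗ H ≈ᴹ I r → (X₀ ⊗ G) ⊗ (H ⊗ Y₀) ≈ᴹ N
    factor-factorises {G} {H} GH≈I = begin
      (X₀ ⊗ G) ⊗ (H ⊗ Y₀)   ≈⟨ ⊗-assoc X₀ G (H ⊗ Y₀) ⟩
      X₀ ⊗ (G ⊗ (H ⊗ Y₀))   ≈⟨ ⊗-congˡ X₀ (⊗-assoc G H Y₀) ⟨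
      X₀ ⊗ ((G ⊗ H) ⊗ Y₀)   ≈⟨ ⊗-congˡ X₀ (⊗-congʳ Y₀ GH≈I) ⟩
      X₀ ⊗ (I r ⊗ Y₀)       ≈⟨ ⊗-congˡ X₀ (⊗-identityˡ Y₀) ⟩
      X₀ ⊗ Y₀               ≈⟨ N≈X₀Y₀ ⟨
      N                     ∎
      where open ≈ᴹ-Reasoning {m} {n}

    factor-injective : ∀ {G H G′ H′ : Matrix r r} →
                       X₀ ⊗ G ≈ᴹ X₀ ⊗ G′ → H ⊗ Y₀ ≈ᴹ H′ ⊗ Y₀ → G ≈ᴹ G′ × H ≈ᴹ H′
    factor-injective {G} {H} {G′} {H′} X₀G≈X₀G′ HY₀≈H′Y₀ = ⊗-cancelˡ independent X₀G≈X₀G′ , (begin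
      H                       ≈⟨ ⊗-identityʳ H ⟨
      H ⊗ I r                 ≈⟨ ⊗-congˡ H selectCols-Y₀≈I ⟨
      selectCols (H ⊗ Y₀) sel ≈⟨ (λ i j → HY₀≈H′Y₀ i (sel j)) ⟩
      H′ ⊗ selectCols Y₀ sel  ≈⟨ ⊗-congˡ H′ selectCols-Y₀≈I ⟩
      H′ ⊗ I r                ≈⟨ ⊗-identityʳ H′ ⟩
      H′                      ∎)
      where open ≈ᴹ-Reasoning {r} {r}

    -- G₀ = Y restricted to sel satisfies X G₀ = X₀, so G₀ ⊗_ is injective on r × r
    -- matrices, hence onto: G₀ H₀ = I for some H₀, and (H₀ , G₀) is the preimage.
    module _ {X : Matrix m r} {Y : Matrix r n} (XY≈N : X ⊗ Y ≈ᴹ N) where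
      private
        G₀ : Matrix r r
        G₀ = selectCols Y sel

        X₀H≈XG₀H : ∀ {k} (H : Matrix r k) → X₀ ⊗ H ≈ᴹ X ⊗ (G₀ ⊗ H)
        X₀H≈XG₀H H = ≈ᴹ-trans (⊗-congʳ H (λ i j → sym (XY≈N i (sel j)))) (⊗-assoc X G₀ H)

        G₀⊗-injective : ∀ {H H′ : Matrix r r} → G₀ ⊗ H ≈ᴹ G₀ ⊗ H′ → H ≈ᴹ H′
        G₀⊗-injective {H} {H′} G₀H≈G₀H′ = ⊗-cancelˡ independent
          (≈ᴹ-trans (X₀H≈XG₀H H) (≈ᴹ-trans (⊗-congˡ X G₀H≈G₀H′) (≈ᴹ-sym (X₀H≈XG₀H H′))))

      module _ {H₀ : Matrix r r} (G₀H₀≈I : G₀ ⊗ H₀ ≈ᴹ I r) where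

        X₀H₀≈X : X₀ ⊗ H₀ ≈ᴹ X
        X₀H₀≈X = begin
          X₀ ⊗ H₀          ≈⟨ X₀H≈XG₀H H₀ ⟩
          X ⊗ (G₀ ⊗ H₀)    ≈⟨ ⊗-congˡ X G₀H₀≈I ⟩
          X ⊗ I r          ≈⟨ ⊗-identityʳ X ⟩
          X                ∎
          where open ≈ᴹ-Reasoning {m} {r}

        H₀G₀≈I : H₀ ⊗ G₀ ≈ᴹ I r
        H₀G₀≈I = ⊗-cancelˡ independent (begin
          X₀ ⊗ (H₀ ⊗ G₀)   ≈⟨ ⊗-assoc X₀ H₀ G₀ ⟨
          (X₀ ⊗ H₀) ⊗ G₀   ≈⟨ ⊗-congʳ G₀ X₀H₀≈X ⟩
          X ⊗ G₀           ≈⟨ (λ i j → XY≈N i (sel j)) ⟩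
          X₀               ≈⟨ ⊗-identityʳ X₀ ⟨
          X₀ ⊗ I r         ∎)
          where open ≈ᴹ-Reasoning {m} {r}

        G₀Y₀≈Y : G₀ ⊗ Y₀ ≈ᴹ Y
        G₀Y₀≈Y = begin
          G₀ ⊗ Y₀          ≈⟨ ⊗-congˡ G₀ H₀Y≈Y₀ ⟨
          G₀ ⊗ (H₀ ⊗ Y)    ≈⟨ ⊗-assoc G₀ H₀ Y ⟨
          (G₀ ⊗ H₀) ⊗ Y    ≈⟨ ⊗-congʳ Y G₀H₀≈I ⟩
          I r ⊗ Y          ≈⟨ ⊗-identityˡ Y ⟩
          Y                ∎
          where
          open ≈ᴹ-Reasoning {r} {n}
          H₀Y≈Y₀ : H₀ ⊗ Y ≈ᴹ Y₀
          H₀Y≈Y₀ = ⊗-cancelˡ independent (≈ᴹ-trans (≈ᴹ-sym (⊗-assoc X₀ H₀ Y))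
                     (≈ᴹ-trans (⊗-congʳ Y X₀H₀≈X) (≈ᴹ-trans XY≈N N≈X₀Y₀)))

      factor-surjective : ¬ ¬ ∃ λ ((G , H) : Matrix r r × Matrix r r) → G ⊗ H ≈ᴹ I r × (X₀ ⊗ G ≈ᴹ X × H ⊗ Y₀ ≈ᴹ Y)
      factor-surjective = ¬¬-map (λ (H₀ , G₀H₀≈I) → (H₀ , G₀) , H₀G₀≈I G₀H₀≈I , X₀H₀≈X G₀H₀≈I , G₀Y₀≈Y G₀H₀≈I)
        (injective⇒surjective (matrices r r) (G₀ ⊗_) G₀⊗-injective (I r))

    #factorisations-I≡ : #factorisations (I r) ≡ #factorisations N
    #factorisations-I≡ = count-bijection (pairs r r) (pairs m n) factor
      (IsFactorisation (I r)) (IsFactorisation N)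
      (λ (G≈G′ , H≈H′) → ==-congˡ (matrices r r) (I r) (⊗-cong G≈G′ H≈H′))
      (λ (X≈X′ , Y≈Y′) → ==-congˡ (matrices m n) N (⊗-cong X≈X′ Y≈Y′))
      (λ (G≈G′ , H≈H′) → ⊗-congˡ X₀ G≈G′ , ⊗-congʳ Y₀ H≈H′)
      (λ GH==I → ≈⇒== (matrices m n) (factor-factorises (==⇒≈ (matrices r r) GH==I)))
      (λ _ _ (X₀G≈X₀G′ , HY₀≈H′Y₀) → factor-injective X₀G≈X₀G′ HY₀≈H′Y₀)
      (λ XY==N → ¬¬-map (λ (GH , GH≈I , factor≈) → GH , ≈⇒== (matrices r r) GH≈I , factor≈)
                        (factor-surjective (==⇒≈ (matrices m n) XY==N)))

  #factorisations-HasRank : ∀ {m n} {N : Matrix m n} → D.HasRank F r N → #factorisations N ≡ #factorisations (I r)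
  #factorisations-HasRank {N = N} ((sel , independent) , maximal) = decidable-stable (_ ≟ℕ _)
    (¬¬-map (λ (Y₀ , N≈X₀Y₀) → ≡.sym (#factorisations-I≡ sel independent Y₀ N≈X₀Y₀))
            (rank-factorisation N sel independent maximal))


module Rationals where

  open import Data.Integer as ℤ using (ℤ; +_; _⊖_; +[1+_])
  import Data.Integer.Properties as ℤ
  open import Data.List using ([]; _∷_)
  open import Data.Nat as ℕ using (ℕ; suc; pred)
  open import Data.Nat.Coprimality using (Coprime)
  import Data.Nat.Properties as ℕ
  open import Data.Rational as ℚ using (ℚ; mkℚ; toℚᵘ)
  import Data.Rational.Properties as ℚ
  open import Data.Rational.Unnormalised as ℚᵘ using (ℚᵘ; mkℚᵘ; _≃_; *≡*; *<*)
  import Data.Rational.Unnormalised.Properties as ℚᵘ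
  open import Relation.Binary.PropositionalEquality
  open import Defs using (sumℚ; _/ℕ_)
  open Counting using (sumℕ)

  toℚᵘ-/ℕ : ∀ n d → toℚᵘ (n /ℕ suc d) ≃ mkℚᵘ (+ n) d
  toℚᵘ-/ℕ n d = ℚ.toℚᵘ-fromℚᵘ (mkℚᵘ (+ n) d)

  +-mkℚᵘ : ∀ m n d → mkℚᵘ (+ m) d ℚᵘ.+ mkℚᵘ (+ n) d ≃ mkℚᵘ (+ (m ℕ.+ n)) d
  +-mkℚᵘ m n d = *≡* (begin
    (+ m ℤ.* + D ℤ.+ + n ℤ.* + D) ℤ.* + D  ≡⟨ cong (ℤ._* + D) (ℤ.*-distribʳ-+ (+ D) (+ m) (+ n)) ⟨
    (+ m ℤ.+ + n) ℤ.* + D ℤ.* + D          ≡⟨ ℤ.*-assoc (+ m ℤ.+ + n) (+ D) (+ D) ⟩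
    (+ m ℤ.+ + n) ℤ.* (+ D ℤ.* + D)        ≡⟨ cong₂ ℤ._*_ (ℤ.pos-+ m n) (ℤ.pos-* D D) ⟨
    + (m ℕ.+ n) ℤ.* + (D ℕ.* D)            ∎)
    where
    open ≡-Reasoning
    D = suc d

  toℚᵘ-sumℚ : ∀ {a} {A : Set a} (f : A → ℚ) (t : A → ℕ) d → (∀ x → toℚᵘ (f x) ≃ mkℚᵘ (+ t x) d) →
              ∀ xs → toℚᵘ (sumℚ f xs) ≃ mkℚᵘ (+ sumℕ t xs) d
  toℚᵘ-sumℚ f t d f≃t []       = *≡* (trans (ℤ.*-zeroˡ (+ suc d)) (sym (ℤ.*-zeroˡ (+ 1))))
  toℚᵘ-sumℚ f t d f≃t (x ∷ xs) = begin
    toℚᵘ (f x ℚ.+ sumℚ f xs)                       ≈⟨ ℚ.toℚᵘ-homo-+ (f x) (sumℚ f xs) ⟩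
    toℚᵘ (f x) ℚᵘ.+ toℚᵘ (sumℚ f xs)               ≈⟨ ℚᵘ.+-cong (f≃t x) (toℚᵘ-sumℚ f t d f≃t xs) ⟩
    mkℚᵘ (+ t x) d ℚᵘ.+ mkℚᵘ (+ sumℕ t xs) d       ≈⟨ +-mkℚᵘ (t x) (sumℕ t xs) d ⟩
    mkℚᵘ (+ (t x ℕ.+ sumℕ t xs)) d                 ∎
    where open ℚᵘ.≃-Reasoning

  toℚᵘ-/ℕ-/ℕ : ∀ x y Q′ A′ → toℚᵘ (x /ℕ suc Q′ ℚ.- y /ℕ suc A′) ≃ mkℚᵘ (+ x) Q′ ℚᵘ.- mkℚᵘ (+ y) A′
  toℚᵘ-/ℕ-/ℕ x y Q′ A′ = ℚᵘ.≃-trans (ℚ.toℚᵘ-homo-+ (x /ℕ suc Q′) (ℚ.- (y /ℕ suc A′)))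
    (ℚᵘ.+-cong (toℚᵘ-/ℕ x Q′) (ℚᵘ.≃-trans (ℚ.toℚᵘ-homo‿- (y /ℕ suc A′)) (ℚᵘ.-‿cong (toℚᵘ-/ℕ y A′))))

  toℚᵘ-∣/ℕ-/ℕ∣ : ∀ x y Q′ A′ → toℚᵘ (ℚ.∣ x /ℕ suc Q′ ℚ.- y /ℕ suc A′ ∣) ≃
                  mkℚᵘ (+ ℤ.∣ x ℕ.* suc A′ ⊖ y ℕ.* suc Q′ ∣) (pred (suc Q′ ℕ.* suc A′))
  toℚᵘ-∣/ℕ-/ℕ∣ x y Q′ A′ = begin
    toℚᵘ (ℚ.∣ x /ℕ suc Q′ ℚ.- y /ℕ suc A′ ∣)   ≈⟨ ℚ.toℚᵘ-homo-∣-∣ (x /ℕ suc Q′ ℚ.- y /ℕ suc A′) ⟩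
    ℚᵘ.∣ toℚᵘ (x /ℕ suc Q′ ℚ.- y /ℕ suc A′) ∣  ≈⟨ ℚᵘ.∣-∣-cong (toℚᵘ-/ℕ-/ℕ x y Q′ A′) ⟩
    ℚᵘ.∣ mkℚᵘ (+ x) Q′ ℚᵘ.- mkℚᵘ (+ y) A′ ∣    ≡⟨ cong (λ z → mkℚᵘ (+ ℤ.∣ z ∣) (pred (suc Q′ ℕ.* suc A′))) numerator ⟩
    mkℚᵘ (+ ℤ.∣ x ℕ.* suc A′ ⊖ y ℕ.* suc Q′ ∣) (pred (suc Q′ ℕ.* suc A′)) ∎
    where
    open ℚᵘ.≃-Reasoning
    numerator : + x ℤ.* + suc A′ ℤ.+ ℤ.- + y ℤ.* + suc Q′ ≡ x ℕ.* suc A′ ⊖ y ℕ.* suc Q′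
    numerator = trans (cong₂ ℤ._+_ (sym (ℤ.pos-* x (suc A′)))
                                   (trans (sym (ℤ.neg-distribˡ-* (+ y) (+ suc Q′))) (cong ℤ.-_ (sym (ℤ.pos-* y (suc Q′))))))
                      (ℤ.m-n≡m⊖n (x ℕ.* suc A′) (y ℕ.* suc Q′))

  mkℚᵘ-cancelʳ : ∀ n d k → mkℚᵘ (+ (n ℕ.* suc k)) (pred (suc d ℕ.* suc k)) ≃ mkℚᵘ (+ n) d
  mkℚᵘ-cancelʳ n d k = *≡* (begin
    + (n ℕ.* suc k) ℤ.* + suc d      ≡⟨ ℤ.pos-* (n ℕ.* suc k) (suc d) ⟨
    + (n ℕ.* suc k ℕ.* suc d)        ≡⟨ cong +_ (trans (ℕ.*-assoc n (suc k) (suc d)) (cong (n ℕ.*_) (ℕ.*-comm (suc k) (suc d)))) ⟩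
    + (n ℕ.* (suc d ℕ.* suc k))      ≡⟨ ℤ.pos-* n (suc d ℕ.* suc k) ⟩
    + n ℤ.* + (suc d ℕ.* suc k)      ∎)
    where open ≡-Reasoning

  /ℕ-<-mkℚ : ∀ x D a d .(cp : Coprime (suc a) (suc d)) → x ℕ.* suc d ℕ.< suc a ℕ.* suc D → x /ℕ suc D ℚ.< mkℚ +[1+ a ] d cp
  /ℕ-<-mkℚ x D a d cp x/D<a/d = ℚ.toℚᵘ-cancel-< (ℚᵘ.<-respˡ-≃ (ℚᵘ.≃-sym (toℚᵘ-/ℕ x D))
    (*<* (subst₂ ℤ._<_ (ℤ.pos-* x (suc d)) (ℤ.pos-* (suc a) (suc D)) (ℤ.+<+ x/D<a/d))))


module TotalVariation {c ℓ} (F : FiniteField c ℓ) (r : ℕ) (rank? : ∀ {m n} (N : Mat F m n) → Dec (HasRank F r N)) where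

  open import Data.Bool using (Bool; true; false; not; _∨_; T)
  open import Data.Fin using (Fin; zero; suc)
  open import Data.Fin.Properties using (all?)
  open import Data.List using (List; length)
  open import Data.Nat using (zero; suc; _+_; _*_; _^_; _∸_; _≤_; _<_; z≤n; pred; >-nonZero)
  open import Data.Nat.Solver using (module +-*-Solver)
  open +-*-Solver using (solve; _:+_; _:*_; _:=_; con)
  open import Data.Integer as ℤ using (+_; _⊖_)
  import Data.Integer.Properties as ℤ
  open import Data.Rational as ℚ using (toℚᵘ)
  import Data.Rational.Properties as ℚ
  open import Data.Rational.Unnormalised as ℚᵘ using (mkℚᵘ; _≃_)
  import Data.Rational.Unnormalised.Properties as ℚᵘ
  open import Defs using (_/ℕ_)
  open Rationals
  open import Data.Nat.Properties
    using (≤-trans; m≤m+n; m+n∸m≡n; suc-pred; m^n≢0; ^-distribˡ-+-*; *-comm; *-identityˡ; *-identityʳ; +-identityʳ)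
  open import Data.Product using (_,_; proj₁; proj₂; uncurry)
  open import Function using (_∘_)
  open import Relation.Binary.PropositionalEquality as ≡ using (_≡_; cong; cong₂; module ≡-Reasoning)
  open import Relation.Nullary using (does; yes; no)
  open import Relation.Nullary.Decidable using (does-⇔; dec-true)
  open import Data.Empty using (⊥-elim)
  open import Data.Unit using (tt)
  open import Relation.Binary.Core using (_Preserves_⟶_)
  open import Function.Bundles using (mk⇔)
  import Defs as D
  open import Defs using (count)
  open Counting
  open Enumerations
  open Matrices F
  open Rank F
  open Fibres F r

  open FiniteField F using (_≟_; q)

  allFin≡all? : ∀ {k p} {P : Fin k → Set p} (b : Fin k → Bool) (P? : ∀ i → Dec (P i)) →
                (∀ i → b i ≡ does (P? i)) → D.allFin F k b ≡ does (all? P?)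
  allFin≡all? {zero}  b P? b≡ = ≡.refl
  allFin≡all? {suc k} b P? b≡ rewrite b≡ zero with P? zero
  ... | yes _ = allFin≡all? (b ∘ suc) (P? ∘ suc) (b≡ ∘ suc)
  ... | no  _ = ≡.refl

  eqM?≡==ᴹ : ∀ {m n} (A B : Matrix m n) → D.eqM? F A B ≡ (A ==ᴹ B)
  eqM?≡==ᴹ {m} {n} A B = allFin≡all? _ (λ i → Enumeration._≟_ (vectors scalars n) (A i) (B i))
    (λ i → allFin≡all? _ (λ j → A i j ≟ B i j) (λ j → ≡.refl))

  #pairsXY≡#factorisations : ∀ {m n} (N : Matrix m n) → D.#pairsXY F r rank? m n N ≡ #factorisations N
  #pairsXY≡#factorisations {m} {n} N = begin
    sumℕ (λ X → count (λ Y → D.eqM? F (X ⊗ Y) N) (D.allMats F r n)) (D.allMats F m r)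
      ≡⟨ sumℕ-cong (D.allMats F m r) (λ X → count≡sumℕ _ (D.allMats F r n)) ⟩
    sumℕ (λ X → sumℕ (λ Y → 𝟙 (D.eqM? F (X ⊗ Y) N)) (D.allMats F r n)) (D.allMats F m r)
      ≡⟨ sumℕ-cartesianProduct _ (D.allMats F m r) (D.allMats F r n) ⟨
    sumℕ (λ (X , Y) → 𝟙 (D.eqM? F (X ⊗ Y) N)) (allPairs m n)
      ≡⟨ count≡sumℕ _ (allPairs m n) ⟨
    count (λ (X , Y) → D.eqM? F (X ⊗ Y) N) (allPairs m n)
      ≡⟨ count-cong (allPairs m n) (λ (X , Y) → eqM?≡==ᴹ (X ⊗ Y) N) ⟩
    #factorisations N
      ∎
    where open ≡-Reasoning

  isRank : ∀ {m n} → Matrix m n → Bool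
  isRank N = does (rank? N)

  isRank-cong : ∀ {m n} → isRank {m} {n} Preserves _≈ᴹ_ ⟶ _≡_
  isRank-cong {x = N} {N′} N≈N′ = does-⇔ (mk⇔ (HasRank-cong N≈N′) (HasRank-cong (≈ᴹ-sym N≈N′))) (rank? N) (rank? N′)

  module _ (m n : ℕ) where

    private
      Ns : List (Matrix m n)
      Ns = D.allMats F m n

    #degenerate : ℕ
    #degenerate = count (λ (X , Y) → not (isRank (X ⊗ Y))) (allPairs m n)

    length-pairs : length (allPairs m n) ≡ q ^ (m * r + r * n)
    length-pairs = begin
      length (allPairs m n)                                  ≡⟨ length-cartesianProduct (D.allMats F m r) (D.allMats F r n) ⟩
      length (D.allMats F m r) * length (D.allMats F r n)  ≡⟨ cong₂ _*_ (length-matrices m r) (length-matrices r n) ⟩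
      q ^ (m * r) * q ^ (r * n)                     ≡⟨ ^-distribˡ-+-* q (m * r) (r * n) ⟨
      q ^ (m * r + r * n)                           ∎
      where open ≡-Reasoning

    sumℕ-#factorisations : ∀ (h : Matrix m n → ℕ) → h Preserves _≈ᴹ_ ⟶ _≡_ →
      sumℕ (λ N → h N * #factorisations N) (D.allMats F m n) ≡ sumℕ (λ (X , Y) → h (X ⊗ Y)) (allPairs m n)
    sumℕ-#factorisations = sumℕ-by-fibres (pairs m n) (matrices m n) (uncurry _⊗_)

    sumℕ-isRank : ∀ x → sumℕ (λ N → 𝟙 (isRank N) * x) (D.allMats F m n) ≡ D.#rank F r rank? m n * x
    sumℕ-isRank x = ≡.trans (sumℕ-*ʳ x (𝟙 ∘ isRank) Ns) (cong (_* x) (≡.sym (count≡sumℕ isRank Ns)))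

    sumℕ-¬isRank : sumℕ (λ N → 𝟙 (not (isRank N)) * #factorisations N) (D.allMats F m n) ≡ #degenerate
    sumℕ-¬isRank = ≡.trans (sumℕ-#factorisations (𝟙 ∘ not ∘ isRank) (cong (𝟙 ∘ not) ∘ isRank-cong))
                           (≡.sym (count≡sumℕ _ (allPairs m n)))

    #rank*#factorisations+#degenerate : D.#rank F r rank? m n * #factorisations (I r) + #degenerate ≡ q ^ (m * r + r * n)
    #rank*#factorisations+#degenerate = begin
      D.#rank F r rank? m n * #factorisations (I r) + #degenerate
        ≡⟨ cong₂ _+_ (sumℕ-isRank (#factorisations (I r))) sumℕ-¬isRank ⟨
      sumℕ (λ N → 𝟙 (isRank N) * #factorisations (I r)) Ns + sumℕ (λ N → 𝟙 (not (isRank N)) * #factorisations N) Ns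
        ≡⟨ cong (_+ sumℕ (λ N → 𝟙 (not (isRank N)) * #factorisations N) Ns) (sumℕ-cong Ns fibre-of-rank) ⟩
      sumℕ (λ N → 𝟙 (isRank N) * #factorisations N) Ns + sumℕ (λ N → 𝟙 (not (isRank N)) * #factorisations N) Ns
        ≡⟨ sumℕ-distrib-+ _ _ Ns ⟨
      sumℕ (λ N → 𝟙 (isRank N) * #factorisations N + 𝟙 (not (isRank N)) * #factorisations N) Ns
        ≡⟨ sumℕ-cong Ns (λ N → 𝟙-split (isRank N) (#factorisations N)) ⟩
      sumℕ (λ N → 1 * #factorisations N) Ns
        ≡⟨ sumℕ-#factorisations (λ _ → 1) (λ _ → ≡.refl) ⟩
      sumℕ (λ _ → 1) (allPairs m n)
        ≡⟨ ≡.trans (sumℕ-const 1 (allPairs m n)) (*-identityʳ _) ⟩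
      length (allPairs m n)
        ≡⟨ length-pairs ⟩
      q ^ (m * r + r * n)
        ∎
      where
      open ≡-Reasoning
      fibre-of-rank : ∀ N → 𝟙 (isRank N) * #factorisations (I r) ≡ 𝟙 (isRank N) * #factorisations N
      fibre-of-rank N with rank? N
      ... | yes hasRank = cong (1 *_) (≡.sym (#factorisations-HasRank hasRank))
      ... | no  _       = ≡.refl

    #degenerate-≤ : ∀ (badX : Matrix m r → Bool) (badY : Matrix r n → Bool) →
      (∀ X → T (not (badX X)) → IdentityRows X) → (∀ Y → T (not (badY Y)) → IdentityColumns Y) →
      #degenerate ≤ count badX (D.allMats F m r) * length (D.allMats F r n) + length (D.allMats F m r) * count badY (D.allMats F r n)
    #degenerate-≤ badX badY goodX goodY =
      ≤-trans (count-mono (allPairs m n) degenerate⇒bad) (count-cartesianProduct-∨ badX badY (D.allMats F m r) (D.allMats F r n))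
      where
      degenerate⇒bad : ∀ XY → T (not (isRank (proj₁ XY ⊗ proj₂ XY))) → T (badX (proj₁ XY) ∨ badY (proj₂ XY))
      degenerate⇒bad (X , Y) ¬rank with badX X in bx | badY Y in by
      ... | true  | _     = tt
      ... | false | true  = tt
      ... | false | false = ⊥-elim (≡.subst (T ∘ not) (dec-true (rank? (X ⊗ Y)) hasRank) ¬rank)
        where
        hasRank : D.HasRank F r (X ⊗ Y)
        hasRank = ⊗-HasRank {X = X} {Y} (goodX X (≡.subst (T ∘ not) (≡.sym bx) tt)) (goodY Y (≡.subst (T ∘ not) (≡.sym by) tt))

    private
      module ClosedForm (A′ Q′ : ℕ) (A≡ : D.#rank F r rank? m n ≡ suc A′) (Q≡ : q ^ (m * r + r * n) ≡ suc Q′) where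

        g : ℕ
        g = #factorisations (I r)

        b : ℕ
        b = #degenerate

        -- Numerator over the common denominator Q A: a rank-r matrix contributes |g A - Q| = b.
        numerator : Matrix m n → ℕ
        numerator N = ℤ.∣ #factorisations N * suc A′ ⊖ 𝟙 (isRank N) * suc Q′ ∣

        term≃ : ∀ N → toℚᵘ (ℚ.∣ D.probXY F r rank? m n N ℚ.- D.probM F r rank? m n N ∣) ≃
                      mkℚᵘ (+ numerator N) (pred (suc Q′ * suc A′))
        term≃ N = ℚᵘ.≃-trans
          (ℚᵘ.≃-reflexive (cong toℚᵘ (cong₂ (λ x y → ℚ.∣ x ℚ.- y ∣)
            (cong₂ _/ℕ_ (#pairsXY≡#factorisations N) Q≡) (cong (𝟙 (isRank N) /ℕ_) A≡))))
          (toℚᵘ-∣/ℕ-/ℕ∣ (#factorisations N) (𝟙 (isRank N)) Q′ A′)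

        numerator≡ : ∀ N → numerator N ≡ 𝟙 (isRank N) * b + 𝟙 (not (isRank N)) * #factorisations N * suc A′
        numerator≡ N with rank? N
        ... | yes hasRank = begin
          ℤ.∣ #factorisations N * suc A′ ⊖ (suc Q′ + 0) ∣   ≡⟨ cong₂ (λ x y → ℤ.∣ x * suc A′ ⊖ y ∣)
                                                                (#factorisations-HasRank hasRank) (+-identityʳ (suc Q′)) ⟩
          ℤ.∣ g * suc A′ ⊖ suc Q′ ∣                         ≡⟨ cong (λ y → ℤ.∣ g * suc A′ ⊖ y ∣) Q≡gA+b ⟨
          ℤ.∣ g * suc A′ ⊖ (g * suc A′ + b) ∣               ≡⟨ ℤ.∣⊖∣-≤ (m≤m+n (g * suc A′) b) ⟩
          g * suc A′ + b ∸ g * suc A′                       ≡⟨ m+n∸m≡n (g * suc A′) b ⟩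
          b                                                 ≡⟨ ≡.trans (+-identityʳ (1 * b)) (*-identityˡ b) ⟨
          1 * b + 0                                         ∎
          where
          open ≡-Reasoning
          Q≡gA+b : g * suc A′ + b ≡ suc Q′
          Q≡gA+b = ≡.trans (cong (_+ b) (≡.trans (*-comm g (suc A′)) (cong (_* g) (≡.sym A≡))))
                           (≡.trans (#rank*#factorisations+#degenerate) Q≡)
        ... | no _ = ≡.trans (ℤ.∣m⊖n∣≡∣n⊖m∣ (#factorisations N * suc A′) 0)
                       (≡.trans (ℤ.∣⊖∣-≤ z≤n) (cong (_* suc A′) (≡.sym (+-identityʳ (#factorisations N)))))

        sum-numerator : sumℕ numerator Ns ≡ 2 * b * suc A′
        sum-numerator = begin
          sumℕ numerator Ns
            ≡⟨ ≡.trans (sumℕ-cong Ns numerator≡) (sumℕ-distrib-+ _ _ Ns) ⟩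
          sumℕ (λ N → 𝟙 (isRank N) * b) Ns + sumℕ (λ N → 𝟙 (not (isRank N)) * #factorisations N * suc A′) Ns
            ≡⟨ cong₂ _+_ (≡.trans (sumℕ-isRank b) (cong (_* b) A≡))
                         (≡.trans (sumℕ-*ʳ (suc A′) _ Ns) (cong (_* suc A′) sumℕ-¬isRank)) ⟩
          suc A′ * b + b * suc A′
            ≡⟨ solve 2 (λ A b → A :* b :+ b :* A := con 2 :* b :* A) ≡.refl (suc A′) b ⟩
          2 * b * suc A′
            ∎
          where open ≡-Reasoning

        tvSum≃ : toℚᵘ (D.tvSum F r rank? m n) ≃ mkℚᵘ (+ sumℕ numerator Ns) (pred (suc Q′ * suc A′))
        tvSum≃ = toℚᵘ-sumℚ (λ N → ℚ.∣ D.probXY F r rank? m n N ℚ.- D.probM F r rank? m n N ∣)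
                           numerator (pred (suc Q′ * suc A′)) term≃ Ns

        tvSum≡ : D.tvSum F r rank? m n ≡ (2 * b) /ℕ suc Q′
        tvSum≡ = ℚ.toℚᵘ-injective (begin
          toℚᵘ (D.tvSum F r rank? m n)                         ≈⟨ tvSum≃ ⟩
          mkℚᵘ (+ sumℕ numerator Ns) (pred (suc Q′ * suc A′))  ≡⟨ cong (λ x → mkℚᵘ (+ x) (pred (suc Q′ * suc A′))) sum-numerator ⟩
          mkℚᵘ (+ (2 * b * suc A′)) (pred (suc Q′ * suc A′))   ≈⟨ mkℚᵘ-cancelʳ (2 * b) Q′ A′ ⟩
          mkℚᵘ (+ (2 * b)) Q′                                  ≈⟨ toℚᵘ-/ℕ (2 * b) Q′ ⟨
          toℚᵘ ((2 * b) /ℕ suc Q′)                             ∎)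
          where open ℚᵘ.≃-Reasoning

    tvSum≡2#degenerate/q^ : 0 < D.#rank F r rank? m n → D.tvSum F r rank? m n ≡ (2 * #degenerate) /ℕ (q ^ (m * r + r * n))
    tvSum≡2#degenerate/q^ 0<A =
      ≡.trans (ClosedForm.tvSum≡ (pred A) (pred Q) A≡ Q≡) (cong ((2 * #degenerate) /ℕ_) (≡.sym Q≡))
      where
      A Q : ℕ
      A = D.#rank F r rank? m n
      Q = q ^ (m * r + r * n)
      A≡ : A ≡ suc (pred A)
      A≡ = ≡.sym (suc-pred A {{>-nonZero 0<A}})
      Q≡ : Q ≡ suc (pred Q)
      Q≡ = ≡.sym (suc-pred Q {{m^n≢0 q (m * r + r * n)}})


module IdentityBlocks {c ℓ} (F : FiniteField c ℓ) (r : ℕ) where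

  open import Data.Bool using (Bool; true; false; not; _∧_; T)
  open import Data.Fin using (_↑ˡ_; _↑ʳ_)
  open import Data.List using (length)
  open import Data.Nat using (zero; suc; _+_; _*_; _^_; _∸_; _≤_)
  open import Data.Nat.Properties using (*-assoc; +-identityʳ; +-assoc; m+[n∸m]≡n)
  open import Data.Product using (_,_)
  open import Data.Unit using (tt)
  open import Function using (_∘_; const)
  open import Relation.Binary.Core using (_Preserves_⟶_)
  open import Relation.Binary.PropositionalEquality as ≡ using (_≡_; cong; cong₂; module ≡-Reasoning)
  import Defs as D
  open import Defs using (count)
  open Counting
  open Enumerations
  open Matrices F
  open Rank F

  open FiniteField F using (reflexive; trans)

  -- blocks K e = K * r + e, unfolded so that Fin (blocks (suc K) e) is Fin (r + blocks K e).
  blocks : ℕ → ℕ → ℕ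
  blocks zero    e = e
  blocks (suc K) e = r + blocks K e

  everyBlock : (Matrix r r → Bool) → ∀ K e → Matrix (blocks K e) r → Bool
  everyBlock p zero    e X = true
  everyBlock p (suc K) e X = p (X ∘ (_↑ˡ blocks K e)) ∧ everyBlock p K e (X ∘ (r ↑ʳ_))

  everyBlock-cong : ∀ {p} → p Preserves _≈ᴹ_ ⟶ _≡_ → ∀ K e → everyBlock p K e Preserves _≈ᴹ_ ⟶ _≡_
  everyBlock-cong p-cong zero    e X≈X′ = ≡.refl
  everyBlock-cong p-cong (suc K) e X≈X′ =
    cong₂ _∧_ (p-cong (X≈X′ ∘ (_↑ˡ blocks K e))) (everyBlock-cong p-cong K e (X≈X′ ∘ (r ↑ʳ_)))

  count-everyBlock : ∀ {p} → p Preserves _≈ᴹ_ ⟶ _≡_ → ∀ K e →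
    count (everyBlock p K e) (D.allMats F (blocks K e) r) ≡ count p (D.allMats F r r) ^ K * length (D.allMats F e r)
  count-everyBlock {p} p-cong zero    e = ≡.trans (count-true (D.allMats F e r)) (≡.sym (+-identityʳ _))
  count-everyBlock {p} p-cong (suc K) e = begin
    count (everyBlock p (suc K) e) (D.allMats F (r + blocks K e) r)
      ≡⟨ count-allFuns-+ (Enumeration.elements (vectors scalars r)) r (blocks K e) p (everyBlock p K e)
           (p-cong ∘ ≗⇒≈ᴹ) (everyBlock-cong p-cong K e ∘ ≗⇒≈ᴹ) ⟩
    count p (D.allMats F r r) * count (everyBlock p K e) (D.allMats F (blocks K e) r)
      ≡⟨ cong (count p (D.allMats F r r) *_) (count-everyBlock p-cong K e) ⟩
    count p (D.allMats F r r) * (count p (D.allMats F r r) ^ K * length (D.allMats F e r))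
      ≡⟨ *-assoc (count p (D.allMats F r r)) _ _ ⟨
    count p (D.allMats F r r) ^ suc K * length (D.allMats F e r)
      ∎
    where open ≡-Reasoning

  length-blocks : ∀ K e → length (D.allMats F (blocks K e) r) ≡ length (D.allMats F r r) ^ K * length (D.allMats F e r)
  length-blocks K e = begin
    length (D.allMats F (blocks K e) r)                       ≡⟨ count-true (D.allMats F (blocks K e) r) ⟨
    count (const true) (D.allMats F (blocks K e) r)           ≡⟨ count-cong (D.allMats F (blocks K e) r) (everyBlock-true K) ⟨
    count (everyBlock (const true) K e) (D.allMats F (blocks K e) r)
                                                              ≡⟨ count-everyBlock (λ _ → ≡.refl) K e ⟩
    count (const true) (D.allMats F r r) ^ K * length (D.allMats F e r)
                                                              ≡⟨ cong (λ x → x ^ K * length (D.allMats F e r)) (count-true (D.allMats F r r)) ⟩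
    length (D.allMats F r r) ^ K * length (D.allMats F e r)   ∎
    where
    open ≡-Reasoning
    everyBlock-true : ∀ K {e} X → everyBlock (const true) K e X ≡ true
    everyBlock-true zero    X = ≡.refl
    everyBlock-true (suc K) X = everyBlock-true K (X ∘ (r ↑ʳ_))

  noIdentityBlock : ∀ K e → Matrix (blocks K e) r → Bool
  noIdentityBlock = everyBlock (λ B → not (I r ==ᴹ B))

  noIdentityBlock-cong : ∀ K e → noIdentityBlock K e Preserves _≈ᴹ_ ⟶ _≡_
  noIdentityBlock-cong = everyBlock-cong (cong not ∘ ==-congʳ (matrices r r) (I r))

  IdentityRows-of-block : ∀ K e X → T (not (noIdentityBlock K e X)) → IdentityRows X
  IdentityRows-of-block zero    e X ()
  IdentityRows-of-block (suc K) e X has-block with I r ==ᴹ (X ∘ (_↑ˡ blocks K e)) in I==top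
  ... | true  = (_↑ˡ blocks K e) , ≈ᴹ-sym (==⇒≈ (matrices r r) (≡.subst T (≡.sym I==top) tt))
  ... | false with IdentityRows-of-block K e (X ∘ (r ↑ʳ_)) has-block
  ...   | ρ , Xρ≈I = (r ↑ʳ_) ∘ ρ , Xρ≈I

  IdentityColumns-of-block : ∀ K e Y → T (not (noIdentityBlock K e (Y ᵀ))) → IdentityColumns Y
  IdentityColumns-of-block K e Y has-block with IdentityRows-of-block K e (Y ᵀ) has-block
  ... | σ , Yσ≈I = σ , λ i j → trans (Yσ≈I j i) (reflexive (δ-sym j i))

  #non-identity : ℕ
  #non-identity = count (λ B → not (I r ==ᴹ B)) (D.allMats F r r)

  suc-#non-identity : suc #non-identity ≡ length (D.allMats F r r)
  suc-#non-identity = suc-count-others (matrices r r) (I r)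

  count-noIdentityBlock : ∀ K e → count (noIdentityBlock K e) (D.allMats F (blocks K e) r) ≡ #non-identity ^ K * length (D.allMats F e r)
  count-noIdentityBlock = count-everyBlock (cong not ∘ ==-congʳ (matrices r r) (I r))

  count-noIdentityBlockᵀ : ∀ K e → count (noIdentityBlock K e ∘ _ᵀ) (D.allMats F r (blocks K e)) ≡ #non-identity ^ K * length (D.allMats F e r)
  count-noIdentityBlockᵀ K e = ≡.trans (count-ᵀ (noIdentityBlock K e) (noIdentityBlock-cong K e)) (count-noIdentityBlock K e)

  blocks-∸ : ∀ K {m} → K * r ≤ m → blocks K (m ∸ K * r) ≡ m
  blocks-∸ K {m} Kr≤m = ≡.trans (blocks≡ K) (m+[n∸m]≡n Kr≤m)
    where
    blocks≡ : ∀ K {e} → blocks K e ≡ K * r + e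
    blocks≡ zero    = ≡.refl
    blocks≡ (suc K) = ≡.trans (cong (r +_) (blocks≡ K)) (≡.sym (+-assoc r (K * r) _))


module Arithmetic where

  open import Algebra.Properties.CommutativeSemigroup using (x∙yz≈y∙xz)
  open import Data.Nat
  open import Data.Nat.Properties
  open import Data.Nat.Solver using (module +-*-Solver)
  open import Relation.Binary.PropositionalEquality
  open +-*-Solver using (solve; _:+_; _:*_; _:=_; con)

  n*m^n≤[1+m]^[1+n] : ∀ m n → n * m ^ n ≤ suc m ^ suc n
  n*m^n≤[1+m]^[1+n] m zero    = z≤n
  n*m^n≤[1+m]^[1+n] m (suc n) = begin
    suc n * m ^ suc n                     ≡⟨ cong (m ^ suc n +_) (x∙yz≈y∙xz *-commutativeSemigroup n m (m ^ n)) ⟩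
    m ^ suc n + m * (n * m ^ n)           ≤⟨ +-mono-≤ (^-monoˡ-≤ (suc n) (n≤1+n m)) (*-monoʳ-≤ m (n*m^n≤[1+m]^[1+n] m n)) ⟩
    suc m ^ suc (suc n)                   ∎
    where open ≤-Reasoning

  k*m^[[1+m]k]≤[1+m]^[[1+m]k] : ∀ m k → k * m ^ (suc m * k) ≤ suc m ^ (suc m * k)
  k*m^[[1+m]k]≤[1+m]^[[1+m]k] m k = *-cancelˡ-≤ (suc m) (begin
    suc m * (k * m ^ K)   ≡⟨ *-assoc (suc m) k (m ^ K) ⟨
    K * m ^ K             ≤⟨ n*m^n≤[1+m]^[1+n] m K ⟩
    suc m ^ suc K         ∎)
    where
    open ≤-Reasoning
    K = suc m * k

  union-bound : ∀ {k b bX bY QX QY} → b ≤ bX * QY + QX * bY → k * bX ≤ QX → k * bY ≤ QY → k * b ≤ 2 * (QX * QY)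
  union-bound {k} {b} {bX} {bY} {QX} {QY} b≤ kbX≤ kbY≤ = begin
    k * b                              ≤⟨ *-monoʳ-≤ k b≤ ⟩
    k * (bX * QY + QX * bY)            ≡⟨ solve 5 (λ k bX QY QX bY → k :* (bX :* QY :+ QX :* bY) := k :* bX :* QY :+ QX :* (k :* bY)) refl k bX QY QX bY ⟩
    k * bX * QY + QX * (k * bY)        ≤⟨ +-mono-≤ (*-monoˡ-≤ QY kbX≤) (*-monoʳ-≤ QX kbY≤) ⟩
    QX * QY + QX * QY                  ≡⟨ cong (QX * QY +_) (+-identityʳ (QX * QY)) ⟨
    2 * (QX * QY)                      ∎
    where open ≤-Reasoning

  2b[1+d]<Q : ∀ b d Q → 0 < Q → 8 * suc d * b ≤ 2 * Q → 2 * b * suc d < Q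
  2b[1+d]<Q b d Q 0<Q 8[1+d]b≤2Q = half-< (*-cancelˡ-≤ 2 (begin
    2 * (2 * (2 * b * suc d))    ≡⟨ solve 2 (λ b d → con 2 :* (con 2 :* (con 2 :* b :* d)) := con 8 :* d :* b) refl b (suc d) ⟩
    8 * suc d * b                ≤⟨ 8[1+d]b≤2Q ⟩
    2 * Q                        ∎))
    where
    open ≤-Reasoning
    half-< : ∀ {x} → 2 * x ≤ Q → x < Q
    half-< {zero}  _   = 0<Q
    half-< {suc x} 2x≤Q = <-≤-trans (m<m+n (suc x) (s≤s z≤n)) (≤-trans (≤-reflexive (cong (suc x +_) (sym (+-identityʳ (suc x))))) 2x≤Q)


module Convergence {c ℓ} (F : FiniteField c ℓ) (r : ℕ)
                   (rank? : ∀ {m n} (N : Mat F m n) → Dec (HasRank F r N)) (d : ℕ) where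

  open import Data.Empty using (⊥-elim)
  open import Data.Integer using (+[1+_])
  open import Data.List using (length)
  open import Data.Nat as ℕ using (zero; suc; _+_; _*_; _^_; _≤_; z≤n; s≤s)
  import Data.Nat.Properties as ℕ
  open import Data.Nat.Coprimality using (Coprime)
  open import Data.Rational using (mkℚ; _<_)
  open import Function using (_∘_)
  open import Relation.Binary.PropositionalEquality as ≡ using (_≡_)
  open import Defs using (allMats; count; tvSum; #rank; _/ℕ_)
  open Counting using (length-cartesianProduct)
  open Arithmetic
  open Rationals using (/ℕ-<-mkℚ)
  open Matrices F
  open Rank F
  open Fibres F r using (#factorisations)
  open TotalVariation F r rank?
  open IdentityBlocks F r
  open FiniteField F using (q)

  -- With K = q^(r²) k blocks, at most a fraction 1 / k of the X (and of the Y) lack an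
  -- identity block, so 2 b / q^(mr+rn) ≤ 4 / k < 1 / (1 + d).
  k : ℕ
  k = 8 * suc d

  K : ℕ
  K = suc #non-identity * k

  k*#noIdentityBlock≤ : ∀ e → k * (#non-identity ^ K * length (allMats F e r)) ≤ length (allMats F (blocks K e) r)
  k*#noIdentityBlock≤ e = begin
    k * (#non-identity ^ K * T)          ≡⟨ ℕ.*-assoc k (#non-identity ^ K) T ⟨
    k * #non-identity ^ K * T            ≤⟨ ℕ.*-monoˡ-≤ T (k*m^[[1+m]k]≤[1+m]^[[1+m]k] #non-identity k) ⟩
    suc #non-identity ^ K * T            ≡⟨ ≡.cong (λ x → x ^ K * T) suc-#non-identity ⟩
    length (allMats F r r) ^ K * T       ≡⟨ length-blocks K e ⟨
    length (allMats F (blocks K e) r)    ∎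
    where
    open ℕ.≤-Reasoning
    T : ℕ
    T = length (allMats F e r)

  module _ (e e′ : ℕ) where

    private
      m n : ℕ
      m = blocks K e
      n = blocks K e′

    k*#degenerate≤ : k * #degenerate m n ≤ 2 * q ^ (m * r + r * n)
    k*#degenerate≤ = ≡.subst (λ Q → k * #degenerate m n ≤ 2 * Q)
      (≡.trans (≡.sym (length-cartesianProduct (allMats F m r) (allMats F r n))) (length-pairs m n))
      (union-bound {k} {#degenerate m n} {count (noIdentityBlock K e) (allMats F m r)} {count (noIdentityBlock K e′ ∘ _ᵀ) (allMats F r n)}
                   {length (allMats F m r)} {length (allMats F r n)}
                   (#degenerate-≤ m n (noIdentityBlock K e) (noIdentityBlock K e′ ∘ _ᵀ)
                                      (IdentityRows-of-block K e) (IdentityColumns-of-block K e′))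
                   k*#badX≤ k*#badY≤)
      where
      k*#badX≤ : k * count (noIdentityBlock K e) (allMats F m r) ≤ length (allMats F m r)
      k*#badX≤ = ≡.subst (λ b → k * b ≤ length (allMats F m r)) (≡.sym (count-noIdentityBlock K e)) (k*#noIdentityBlock≤ e)
      k*#badY≤ : k * count (noIdentityBlock K e′ ∘ _ᵀ) (allMats F r n) ≤ length (allMats F r n)
      k*#badY≤ = ≡.subst₂ (λ b Q → k * b ≤ Q) (≡.sym (count-noIdentityBlockᵀ K e′))
        (≡.trans (length-matrices n r) (≡.trans (≡.cong (q ^_) (ℕ.*-comm n r)) (≡.sym (length-matrices r n))))
        (k*#noIdentityBlock≤ e′)

    2#degenerate[1+d]<q^ : 2 * #degenerate m n * suc d ℕ.< q ^ (m * r + r * n)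
    2#degenerate[1+d]<q^ = 2b[1+d]<Q (#degenerate m n) d _ (ℕ.m^n>0 q (m * r + r * n)) k*#degenerate≤

    0<#rank : 0 ℕ.< #rank F r rank? m n
    0<#rank with #rank F r rank? m n in #rank≡
    ... | suc _ = s≤s z≤n
    ... | zero  = ⊥-elim (ℕ.<-irrefl b≡Q (ℕ.≤-<-trans b≤2b[1+d] 2#degenerate[1+d]<q^))
      where
      b≡Q : #degenerate m n ≡ q ^ (m * r + r * n)
      b≡Q = ≡.trans (≡.cong (λ A → A * #factorisations (I r) + #degenerate m n) (≡.sym #rank≡)) (#rank*#factorisations+#degenerate m n)
      b≤2b[1+d] : #degenerate m n ℕ.≤ 2 * #degenerate m n * suc d
      b≤2b[1+d] = ℕ.≤-trans (ℕ.m≤m+n _ _) (ℕ.m≤m*n (2 * #degenerate m n) (suc d))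

    tvSum< : ∀ a .(cp : Coprime (suc a) (suc d)) → tvSum F r rank? m n < mkℚ +[1+ a ] d cp
    tvSum< a cp = ≡.subst (_< mkℚ +[1+ a ] d cp) (≡.sym (tvSum≡2#degenerate/q^ m n 0<#rank))
      (≡.subst (λ Q → (2 * #degenerate m n) /ℕ Q < mkℚ +[1+ a ] d cp) (ℕ.suc-pred Q)
        (/ℕ-<-mkℚ (2 * #degenerate m n) (ℕ.pred Q) a d cp
          (ℕ.<-≤-trans (≡.subst (2 * #degenerate m n * suc d ℕ.<_) (≡.sym (ℕ.suc-pred Q)) 2#degenerate[1+d]<q^)
                       (ℕ.m≤n*m (suc (ℕ.pred Q)) (suc a)))))
      where
      Q : ℕ
      Q = q ^ (m * r + r * n)
      instance
        Q-nonZero : ℕ.NonZero Q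
        Q-nonZero = ℕ.m^n≢0 q (m * r + r * n)

open import Data.Empty using (⊥-elim)
open import Data.Integer as ℤ using (+_; +[1+_]; -[1+_])
open import Data.Nat using (zero; _≤_; _*_; _∸_)
open import Data.Product using (∃; _,_)
open import Data.Rational using (ℚ; mkℚ; Positive; _<_)
open import Relation.Binary.PropositionalEquality using (subst₂)
open import Defs using (tvSum)

-- 0 < r, r ≤ m and r ≤ n are unused: the argument also covers r = 0.
lemma4p2 : ∀ {c ℓ} (F : FiniteField c ℓ) (r : ℕ) → 0 Data.Nat.< r →
    (rank? : ∀ {m n} (N : Mat F m n) → Dec (HasRank F r N)) →
    ∀ (ε : ℚ) → Positive ε →
    ∃ λ (N₀ : ℕ) → ∀ (m n : ℕ) → r ≤ m → r ≤ n → N₀ ≤ m → N₀ ≤ n →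
      tvSum F r rank? m n < ε
lemma4p2 F r _ rank? (mkℚ (+ zero)   d cp) ε>0 = ⊥-elim (ℤ.Positive.pos ε>0)
lemma4p2 F r _ rank? (mkℚ -[1+ a ]   d cp) ε>0 = ⊥-elim (ℤ.Positive.pos ε>0)
lemma4p2 F r _ rank? (mkℚ +[1+ a ]   d cp) _   = K * r , λ m n _ _ Kr≤m Kr≤n →
  subst₂ (λ m n → tvSum F r rank? m n < mkℚ +[1+ a ] d cp) (blocks-∸ K Kr≤m) (blocks-∸ K Kr≤n)
    (tvSum< (m ∸ K * r) (n ∸ K * r) a cp)
  where
  open Convergence F r rank? d
  open IdentityBlocks F r using (blocks-∸)
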